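{- Let $\gamma$ be the circular order on $\mathbb{Q}$, i.e. $\gamma(a,b,c)\iff(a<b<c)\vee(b<c<a)\vee(c<a<b)$. Then the Fraïssé structure $(\mathbb{Q},\gamma)$ has a local SWIR and a Katětov functor.
   Context: $(\mathbb{Q},\gamma)$ is countable and ultrahomogeneous. For a Fraïssé structure $M$: $\mathcal{A}(M)$ (resp. $\mathcal{A}_\omega(M)$) is the category of non-empty finite (resp. all non-empty, finite or countable) structures embeddable in $M$ with embeddings as morphisms. A one-point extension is an embedding $\zeta:A\to B$ in $\mathcal{A}(M)$ with $B=\zeta(A)\cup\{e\}$, $e\notin\zeta(A)$. A Katětov functor for $M$ is a functor $K:\mathcal{A}(M)\to\mathcal{A}_\omega(M)$ with embeddings $\eta_A:A\to K(A)$ such that $K(f)\circ\eta_A=\eta_B\circ f$ for all embeddings $f:A\to B$, and for each one-point extension $\zeta:A\to B$ there is an embedding $f:B\to K(A)$ with $f\circ\zeta=\eta_A$. A local SWIR on $M$ is a ternary relation $B\mathop{\smile\!\!\!\!\!\!|}_A C$ on finite substructures with $A$ non-empty satisfying, with $AB$ the substructure on $A\cup B$: Invariance under $\mathrm{Aut}(M)$; Existence (for all $A,B,C$ there is $g\in\mathrm{Aut}(M)$ fixing $A$ pointwise with $gB\mathop{\smile\!\!\!\!\!\!|}_A C$, and $h$ fixing $A$ pointwise with $B\mathop{\smile\!\!\!\!\!\!|}_A hC$); Stationarity (if $B\mathop{\smile\!\!\!\!\!\!|}_A C$, $B'\mathop{\smile\!\!\!\!\!\!|}_A C$ and an automorphism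 fixing $A$ pointwise restricts to $\sigma:B\to B'$, then an automorphism fixing $AC$ pointwise restricts to $\sigma$; and the symmetric right version); Monotonicity ($BD\mathop{\smile\!\!\!\!\!\!|}_A C\Rightarrow B\mathop{\smile\!\!\!\!\!\!|}_A C\wedge D\mathop{\smile\!\!\!\!\!\!|}_{AB}C$; $B\mathop{\smile\!\!\!\!\!\!|}_A CD\Rightarrow B\mathop{\smile\!\!\!\!\!\!|}_A C\wedge B\mathop{\smile\!\!\!\!\!\!|}_{AC}D$). -}

module Defs where

open import Data.Rational using (ℚ; _<_)
open import Data.Nat using (ℕ)
open import Data.Fin using (Fin)
open import Data.List using (List; map; _++_)
open import Data.List.Membership.Propositional using (_∈_)
open import Data.Product using (Σ; ∃; _×_; _,_)
open import Data.Sum using (_⊎_)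
open import Relation.Nullary using (¬_)
open import Relation.Binary.PropositionalEquality using (_≡_)
open import Function.Bundles using (_⇔_; _↔_)
open import Function.Definitions using (Injective)

γ : ℚ → ℚ → ℚ → Set
γ a b c = (a < b × b < c) ⊎ ((b < c × c < a) ⊎ (c < a × a < b))

record Aut : Set where
  field
    fun   : ℚ → ℚ
    inv   : ℚ → ℚ
    left  : ∀ x → inv (fun x) ≡ x
    right : ∀ x → fun (inv x) ≡ x
    pres  : ∀ a b c → γ a b c ⇔ γ (fun a) (fun b) (fun c)
open Aut public

-- Finite substructures of (ℚ, γ) are represented by finite lists of
-- elements, considered up to having the same elements.
SameSet : List ℚ → List ℚ → Set
SameSet xs ys = ∀ x → (x ∈ xs ⇔ x ∈ ys)

NonEmpty : List ℚ → Set
NonEmpty xs = ∃ λ x → x ∈ xs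

Fixes : Aut → List ℚ → Set
Fixes g A = ∀ x → x ∈ A → fun g x ≡ x

-- Local SWIR.  ind B A C  means  B ⫫_A C.
-- The unions AB etc. are A ++ B.

record LocalSWIR : Set₁ where
  field
    ind : List ℚ → List ℚ → List ℚ → Set
    -- it is a relation on finite substructures (sets), not on lists
    respects : ∀ {A A' B B' C C'} → NonEmpty A →
      SameSet A A' → SameSet B B' → SameSet C C' → ind B A C → ind B' A' C'
    invariance : ∀ (g : Aut) A B C → NonEmpty A → ind B A C →
      ind (map (fun g) B) (map (fun g) A) (map (fun g) C)
    existenceˡ : ∀ A B C → NonEmpty A →
      Σ Aut λ g → Fixes g A × ind (map (fun g) B) A C
    existenceʳ : ∀ A B C → NonEmpty A →
      Σ Aut λ h → Fixes h A × ind B A (map (fun h) C)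
    stationarityˡ : ∀ A B B' C → NonEmpty A → ind B A C → ind B' A C →
      (g : Aut) → Fixes g A → SameSet (map (fun g) B) B' →
      Σ Aut λ h → Fixes h (A ++ C) × (∀ x → x ∈ B → fun h x ≡ fun g x)
    stationarityʳ : ∀ A B C C' → NonEmpty A → ind B A C → ind B A C' →
      (g : Aut) → Fixes g A → SameSet (map (fun g) C) C' →
      Σ Aut λ h → Fixes h (A ++ B) × (∀ x → x ∈ C → fun h x ≡ fun g x)
    monotonicityˡ : ∀ A B D C → NonEmpty A → ind (B ++ D) A C →
      ind B A C × ind D (A ++ B) C
    monotonicityʳ : ∀ A B C D → NonEmpty A → ind B A (C ++ D) →
      ind B A C × ind B (A ++ C) D

record Str : Set₁ where
  field
    Carrier : Set
    R       : Carrier → Carrier → Carrier → Set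
open Str public

ℚγ : Str
ℚγ = record { Carrier = ℚ ; R = γ }

record Emb (X Y : Str) : Set where
  field
    emb  : Carrier X → Carrier Y
    inj  : Injective _≡_ _≡_ emb
    pres : ∀ a b c → R X a b c ⇔ R Y (emb a) (emb b) (emb c)
open Emb public

idₑ : ∀ {X} → Emb X X
idₑ = record { emb = λ x → x ; inj = λ p → p ; pres = λ a b c → record
  { to = λ r → r ; from = λ r → r ; to-cong = λ p → p ; from-cong = λ p → p } }

_∘ₑ_ : ∀ {X Y Z} → Emb Y Z → Emb X Y → Emb X Z
g ∘ₑ f = record
  { emb = λ x → emb g (emb f x)
  ; inj = λ p → inj f (inj g p)
  ; pres = λ a b c → record
      { to = λ r → Function.Bundles.Equivalence.to (pres g _ _ _)
                     (Function.Bundles.Equivalence.to (pres f a b c) r)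
      ; from = λ r → Function.Bundles.Equivalence.from (pres f a b c)
                     (Function.Bundles.Equivalence.from (pres g _ _ _) r)
      ; to-cong = λ { _≡_.refl → _≡_.refl }
      ; from-cong = λ { _≡_.refl → _≡_.refl } } }

_≈ₑ_ : ∀ {X Y} → Emb X Y → Emb X Y → Set
f ≈ₑ g = ∀ x → emb f x ≡ emb g x

IsFinite : Str → Set
IsFinite X = Σ ℕ λ n → Carrier X ↔ Fin n

IsCountable : Str → Set
IsCountable X = Σ (Carrier X → ℕ) λ c → Injective _≡_ _≡_ c

record FinObj : Set₁ where
  field
    str      : Str
    finite   : IsFinite str
    nonempty : Carrier str
    embM     : Emb str ℚγ

record CtblObj : Set₁ where
  field
    str      : Str
    countable : IsCountable str
    nonempty : Carrier str
    embM     : Emb str ℚγ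

open FinObj using () renaming (str to fstr)
open CtblObj using () renaming (str to cstr)

OnePointExt : ∀ {A B} → Emb A B → Set
OnePointExt {A} {B} ζ = Σ (Carrier B) λ e →
  (∀ b → b ≡ e ⊎ (∃ λ a → emb ζ a ≡ b)) × (∀ a → ¬ (emb ζ a ≡ e))

record KatetovFunctor : Set₁ where
  field
    K₀   : FinObj → CtblObj
    K₁   : ∀ {A B} → Emb (fstr A) (fstr B) → Emb (cstr (K₀ A)) (cstr (K₀ B))
    K-cong : ∀ {A B} {f g : Emb (fstr A) (fstr B)} → f ≈ₑ g → K₁ {A} {B} f ≈ₑ K₁ {A} {B} g
    K-id : ∀ A → _≈ₑ_ {cstr (K₀ A)} {cstr (K₀ A)} (K₁ (idₑ {fstr A})) (idₑ {cstr (K₀ A)})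
    K-∘  : ∀ {A B C} (g : Emb (fstr B) (fstr C)) (f : Emb (fstr A) (fstr B)) →
           K₁ (_∘ₑ_ {fstr A} {fstr B} {fstr C} g f) ≈ₑ
           (_∘ₑ_ {cstr (K₀ A)} {cstr (K₀ B)} {cstr (K₀ C)} (K₁ g) (K₁ f))
    η    : ∀ A → Emb (fstr A) (cstr (K₀ A))
    natural : ∀ {A B} (f : Emb (fstr A) (fstr B)) → _∘ₑ_ {fstr A} {cstr (K₀ A)} {cstr (K₀ B)} (K₁ f) (η A) ≈ₑ
      _∘ₑ_ {fstr A} {fstr B} {cstr (K₀ B)} (η B) f
    katetov : ∀ {A B} (ζ : Emb (fstr A) (fstr B)) → OnePointExt ζ →
      Σ (Emb (fstr B) (cstr (K₀ A))) λ f →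
      _∘ₑ_ {fstr A} {fstr B} {cstr (K₀ A)} f ζ ≈ₑ η A

{-# OPTIONS --safe #-}
-- Cutting the circle open at a point a₀ turns γ into the cyclic closure of a dense
-- linear order with least element a₀. Hence a back-and-forth argument extends every
-- finite partial isomorphism of that order fixing a₀ to an automorphism of (ℚ, γ).
--
-- B ⫫_A C says that inside every arc cut out by A the points of B come before those
-- of C. Existence is obtained one point at a time, moving a point of B to the start
-- of its arc; stationarity holds because independence fixes the position of each
-- point of B relative to C, so the required automorphism again comes from back and
-- forth; the right-hand axioms follow from the left ones through the reflection
-- x ↦ -x, which reverses γ.
--
-- The Katětov functor sends A to A × {0, 1} ordered lexicographically, (a, 1) being
-- a new point right after a. A one-point extension of A by e is realised by sending
-- e to (p, 1), where p is the last point of A before e.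
module Submission where

open import Defs
open import Data.Bool as Bool using (Bool; true; false)
import Data.Bool.Properties as Bool
open import Data.Empty using (⊥-elim)
open import Data.Fin using (Fin; toℕ; combine)
open import Data.Fin.Properties using (toℕ-injective; combine-injective; 2↔Bool)
open import Data.Integer as ℤ using (ℤ; +_; -[1+_])
open import Data.List using (List; []; _∷_; map; _++_; upTo; allFin; cartesianProductWith)
open import Data.List.Membership.Propositional using (_∈_; _∉_)
open import Data.List.Membership.Propositional.Properties
  using (∈-map⁺; ∈-map⁻; ∈-++⁺ˡ; ∈-++⁺ʳ; ∈-++⁻; ∈-upTo⁺; ∈-allFin; ∈-cartesianProductWith⁺)
open import Data.List.Properties using (map-∘; map-++; map-id-local)
open import Data.List.Relation.Binary.Subset.Propositional using (_⊆_)
open import Data.List.Relation.Unary.All as All using (All)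
open import Data.List.Relation.Unary.Any using (here; there)
open import Data.Nat as ℕ using (ℕ; zero; suc; _⊔_)
import Data.Nat.Properties as ℕ
open import Data.Product using (Σ; ∃; _×_; _,_; proj₁; proj₂; swap)
import Data.Product as Product
open import Data.Product.Relation.Binary.Lex.Strict using (×-Lex; ×-irreflexive; ×-asymmetric; ×-compare)
open import Data.Product.Relation.Binary.Pointwise.NonDependent using (≡×≡⇒≡; ≡⇒≡×≡)
open import Data.Rational using (ℚ; _<_; _≤_; _+_; -_; _/_; 1ℚ; ↥_; ↧ₙ_)
open import Data.Rational.Properties
  using (_≟_; _≤?_; <-cmp; <-irrefl; <-asym; <-trans; <-≤-trans; ≤-<-trans; <⇒≤; ≰⇒>; ≤-refl; <-dense;
         <-isDenseLinearOrder; +-monoʳ-<; +-identityʳ; positive⁻¹; ↥p/↧p≡p; neg-antimono-<; +-0-group)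
open import Algebra.Properties.Group +-0-group using () renaming (⁻¹-involutive to neg-involutive)
open import Data.Sum using (_⊎_; inj₁; inj₂; [_,_])
import Data.Sum as Sum
open import Data.Unit using (⊤; tt)
open import Function using (_∘_; flip; case_of_)
open import Function.Bundles using (_⇔_; mk⇔; _↔_; mk↔ₛ′; Inverse; Injection; Equivalence)
open import Function.Properties.Equivalence using () renaming (trans to ⇔-trans; sym to ⇔-sym; refl to ⇔-refl)
open import Function.Properties.Inverse using (↔⇒↣; ↔-sym)
open import Relation.Binary.Definitions using (Transitive; Irreflexive; Asymmetric; Decidable; Trichotomous; Tri; tri<; tri≈; tri>)
open import Relation.Binary.PropositionalEquality as ≡ using (_≡_; _≢_; refl; sym; trans; cong; cong₂; subst)
open import Relation.Binary.Structures using (IsStrictTotalOrder; IsDenseLinearOrder)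
open import Relation.Nullary using (¬_; yes; no)
import Relation.Unary as U

open Equivalence using (to; from)
open import Data.List.Membership.DecPropositional _≟_ using (_∈?_)

-- Cyclic orders

Cyclic : {X : Set} → (X → X → Set) → X → X → X → Set
Cyclic R x y z = (R x y × R y z) ⊎ ((R y z × R z x) ⊎ (R z x × R x y))

module _ {X : Set} (R : X → X → Set) where

  Cyclic-rotate : ∀ {x y z} → Cyclic R x y z → Cyclic R y z x
  Cyclic-rotate (inj₁ p)        = inj₂ (inj₂ p)
  Cyclic-rotate (inj₂ (inj₁ p)) = inj₁ p
  Cyclic-rotate (inj₂ (inj₂ p)) = inj₂ (inj₁ p)

  Cyclic-rotate⇔ : ∀ {x y z} → Cyclic R x y z ⇔ Cyclic R y z x
  Cyclic-rotate⇔ = mk⇔ Cyclic-rotate (Cyclic-rotate ∘ Cyclic-rotate)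

  Cyclic-reduce : ∀ {x y z} → (R y z × ¬ R z x) ⊎ (¬ R y z × R z x) → Cyclic R x y z ⇔ R x y
  Cyclic-reduce (inj₁ (yz , ¬zx)) = mk⇔
    (λ { (inj₁ (xy , _)) → xy ; (inj₂ (inj₁ (_ , zx))) → ⊥-elim (¬zx zx) ; (inj₂ (inj₂ (zx , _))) → ⊥-elim (¬zx zx) })
    (λ xy → inj₁ (xy , yz))
  Cyclic-reduce (inj₂ (¬yz , zx)) = mk⇔
    (λ { (inj₁ (_ , yz)) → ⊥-elim (¬yz yz) ; (inj₂ (inj₁ (yz , _))) → ⊥-elim (¬yz yz) ; (inj₂ (inj₂ (_ , xy))) → xy })
    (λ xy → inj₂ (inj₂ (zx , xy)))

  module _ (irrefl : ∀ {x} → ¬ R x x) (asym : ∀ {x y} → R x y → ¬ R y x) where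

    Cyclic-irrefl₁₂ : ∀ {x z} → ¬ Cyclic R x x z
    Cyclic-irrefl₁₂ (inj₁ (xx , _))        = irrefl xx
    Cyclic-irrefl₁₂ (inj₂ (inj₁ (xz , zx))) = asym xz zx
    Cyclic-irrefl₁₂ (inj₂ (inj₂ (_ , xx)))  = irrefl xx

    Cyclic-irrefl₂₃ : ∀ {x y} → ¬ Cyclic R x y y
    Cyclic-irrefl₂₃ = Cyclic-irrefl₁₂ ∘ Cyclic-rotate

    Cyclic-irrefl₁₃ : ∀ {x y} → ¬ Cyclic R x y x
    Cyclic-irrefl₁₃ = Cyclic-irrefl₁₂ ∘ Cyclic-rotate ∘ Cyclic-rotate

Cyclic-⇔ : ∀ {X Y : Set} (R : X → X → Set) (S : Y → Y → Set) {x y z x' y' z'} →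
  (R x y ⇔ S x' y') → (R y z ⇔ S y' z') → (R z x ⇔ S z' x') → Cyclic R x y z ⇔ Cyclic S x' y' z'
Cyclic-⇔ R S xy yz zx = mk⇔
  (Sum.map (Product.map (to xy) (to yz)) (Sum.map (Product.map (to yz) (to zx)) (Product.map (to zx) (to xy))))
  (Sum.map (Product.map (from xy) (from yz)) (Sum.map (Product.map (from yz) (from zx)) (Product.map (from zx) (from xy))))

-- Dense linear orders and back and forth

maximal? : ∀ {E K : Set} {R : K → K → Set} → Irreflexive _≡_ R → Transitive R → Decidable R →
  (key : E → K) (P : E → Set) → U.Decidable P → (xs : List E) →
  (Σ E λ m → m ∈ xs × P m × (∀ {z} → z ∈ xs → P z → ¬ R (key m) (key z))) ⊎ (∀ {z} → z ∈ xs → ¬ P z)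
maximal? irrefl trans R? key P P? [] = inj₂ λ ()
maximal? irrefl trans R? key P P? (x ∷ xs) with maximal? irrefl trans R? key P P? xs | P? x
... | inj₂ none | no ¬px = inj₂ λ { (here refl) → ¬px ; (there z∈) → none z∈ }
... | inj₂ none | yes px = inj₁ (x , here refl , px , λ { (here refl) _ → irrefl refl ; (there z∈) pz → ⊥-elim (none z∈ pz) })
... | inj₁ (m , m∈ , pm , max) | no ¬px =
  inj₁ (m , there m∈ , pm , λ { (here refl) px → ⊥-elim (¬px px) ; (there z∈) → max z∈ })
... | inj₁ (m , m∈ , pm , max) | yes px with R? (key m) (key x)
...   | yes m≺x = inj₁ (x , here refl , px , λ { (here refl) _ → irrefl refl ; (there z∈) pz x≺z → max z∈ pz (trans m≺x x≺z) })
...   | no m⊀x = inj₁ (m , there m∈ , pm , λ { (here refl) _ → m⊀x ; (there z∈) → max z∈ })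

module StrictTotalOrderFacts {T : Set} {_≺_ : T → T → Set} (isSTO : IsStrictTotalOrder _≡_ _≺_) where

  open IsStrictTotalOrder isSTO using (compare) renaming (irrefl to ≺-irrefl; trans to ≺-trans; asym to ≺-asym; _<?_ to _≺?_)

  ≮⇒≽ : ∀ {x y} → ¬ x ≺ y → y ≡ x ⊎ y ≺ x
  ≮⇒≽ {x} {y} x⊀y with compare x y
  ... | tri< x≺y _ _ = ⊥-elim (x⊀y x≺y)
  ... | tri≈ _ x≡y _ = inj₁ (sym x≡y)
  ... | tri> _ _ y≺x = inj₂ y≺x

  flip⇔ : ∀ {a x y} → x ≢ a → y ≢ a → (a ≺ x ⇔ a ≺ y) → (x ≺ a ⇔ y ≺ a)
  flip⇔ {a} {x} {y} x≢a y≢a a≺x⇔a≺y = mk⇔ (flipped y≢a (from a≺x⇔a≺y)) (flipped x≢a (to a≺x⇔a≺y))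
    where
    flipped : ∀ {x y} → y ≢ a → (a ≺ y → a ≺ x) → x ≺ a → y ≺ a
    flipped {y = y} y≢a a≺y→a≺x x≺a with compare y a
    ... | tri< y≺a _ _ = y≺a
    ... | tri≈ _ y≡a _ = ⊥-elim (y≢a y≡a)
    ... | tri> _ _ a≺y = ⊥-elim (≺-asym x≺a (a≺y→a≺x a≺y))

  ⇔-by-trichotomy : ∀ {a x y} → x ≢ a → y ≢ a → (a ≺ x → a ≺ y) → (x ≺ a → y ≺ a) → a ≺ x ⇔ a ≺ y
  ⇔-by-trichotomy {a} {x} x≢a _ below above = mk⇔ below λ a≺y → case compare x a of λ
    { (tri< x≺a _ _) → ⊥-elim (≺-asym a≺y (above x≺a))
    ; (tri≈ _ x≡a _) → ⊥-elim (x≢a x≡a)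
    ; (tri> _ _ a≺x) → a≺x }

  greatest : ∀ {E : Set} (key : E → T) {xs : List E} {x₀} → x₀ ∈ xs →
    Σ E λ m → m ∈ xs × (∀ {z} → z ∈ xs → ¬ key m ≺ key z)
  greatest key {xs} x₀∈ with maximal? ≺-irrefl ≺-trans _≺?_ key (λ _ → ⊤) (λ _ → yes tt) xs
  ... | inj₁ (m , m∈ , _ , max) = m , m∈ , λ z∈ → max z∈ tt
  ... | inj₂ none = ⊥-elim (none x₀∈ tt)

  predecessor : ∀ {S x s₀} → s₀ ∈ S → s₀ ≺ x →
    Σ T λ p → p ∈ S × p ≺ x × (∀ {s} → s ∈ S → s ≺ x → s ≡ p ⊎ s ≺ p)
  predecessor {S} {x} s₀∈ s₀≺x with maximal? ≺-irrefl ≺-trans _≺?_ (λ s → s) (_≺ x) (_≺? x) S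
  ... | inj₁ (p , p∈ , p≺x , max) = p , p∈ , p≺x , λ s∈ s≺x → ≮⇒≽ (max s∈ s≺x)
  ... | inj₂ none = ⊥-elim (none s₀∈ s₀≺x)

  successor : ∀ S x →
    (Σ T λ q → q ∈ S × x ≺ q × (∀ {s} → s ∈ S → x ≺ s → q ≡ s ⊎ q ≺ s)) ⊎ (∀ {s} → s ∈ S → ¬ x ≺ s)
  successor S x with maximal? (λ e → ≺-irrefl (sym e)) (flip ≺-trans) (flip _≺?_) (λ s → s) (x ≺_) (x ≺?_) S
  ... | inj₁ (q , q∈ , x≺q , min) = inj₁ (q , q∈ , x≺q , λ s∈ x≺s → ≮⇒≽ (min s∈ x≺s))
  ... | inj₂ none = inj₂ none

module DenseOrder {T : Set} {_≺_ : T → T → Set} (isDLO : IsDenseLinearOrder _≡_ _≺_)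
  (unbounded : ∀ x → ∃ (x ≺_)) where

  open IsDenseLinearOrder isDLO using (isStrictTotalOrder; dense) renaming (trans to ≺-trans)
  open StrictTotalOrderFacts isStrictTotalOrder public

  justAbove : ∀ S x → Σ T λ y → x ≺ y × (∀ {s} → s ∈ S → x ≺ s → y ≺ s)
  justAbove S x with successor S x
  ... | inj₂ none = proj₁ (unbounded x) , proj₂ (unbounded x) , λ s∈ x≺s → ⊥-elim (none s∈ x≺s)
  ... | inj₁ (q , _ , x≺q , min) with dense x≺q
  ...   | y , x≺y , y≺q = y , x≺y , λ s∈ x≺s → Sum.[ (λ { refl → y≺q }) , ≺-trans y≺q ] (min s∈ x≺s)

module BackAndForth {T : Set} {_≺_ : T → T → Set} (isDLO : IsDenseLinearOrder _≡_ _≺_)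
  (unbounded : ∀ x → ∃ (x ≺_)) (⊥₀ : T) (⊥₀-least : ∀ {x} → x ≢ ⊥₀ → ⊥₀ ≺ x)
  (enumerate : ℕ → List T) (enumerate-complete : ∀ x → ∃ λ n → x ∈ enumerate n) where

  open IsDenseLinearOrder isDLO using (compare)
    renaming (_≟_ to _≟ᵀ_; irrefl to ≺-irrefl; trans to ≺-trans; asym to ≺-asym)
  open DenseOrder isDLO unbounded using (predecessor; justAbove)

  PartialIso : List (T × T) → Set
  PartialIso ps = ∀ {u v u' v'} → (u , v) ∈ ps → (u' , v') ∈ ps → (u ≺ u' → v ≺ v') × (v ≺ v' → u ≺ u')

  module _ {ps : List (T × T)} (iso : PartialIso ps) where

    PartialIso-functional : ∀ {u v v'} → (u , v) ∈ ps → (u , v') ∈ ps → v ≡ v'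
    PartialIso-functional p q with compare _ _
    ... | tri< v≺v' _ _ = ⊥-elim (≺-irrefl refl (proj₂ (iso p q) v≺v'))
    ... | tri≈ _ v≡v' _ = v≡v'
    ... | tri> _ _ v'≺v = ⊥-elim (≺-irrefl refl (proj₂ (iso q p) v'≺v))

    PartialIso-injective : ∀ {u u' v} → (u , v) ∈ ps → (u' , v) ∈ ps → u ≡ u'
    PartialIso-injective p q with compare _ _
    ... | tri< u≺u' _ _ = ⊥-elim (≺-irrefl refl (proj₁ (iso p q) u≺u'))
    ... | tri≈ _ u≡u' _ = u≡u'
    ... | tri> _ _ u'≺u = ⊥-elim (≺-irrefl refl (proj₁ (iso q p) u'≺u))

  ∈-swap⁻ : ∀ {u v} {ps : List (T × T)} → (v , u) ∈ map swap ps → (u , v) ∈ ps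
  ∈-swap⁻ m with ∈-map⁻ swap m
  ... | _ , m' , refl = m'

  PartialIso-swap : ∀ {ps} → PartialIso ps → PartialIso (map swap ps)
  PartialIso-swap iso p q = swap (iso (∈-swap⁻ p) (∈-swap⁻ q))

  -- The pair (⊥₀ , ⊥₀) gives every new point a predecessor in the domain.
  record Approximation : Set where
    field
      pairs        : List (T × T)
      isPartialIso : PartialIso pairs
      ⊥₀↦⊥₀        : (⊥₀ , ⊥₀) ∈ pairs
  open Approximation

  inverse : Approximation → Approximation
  inverse s = record
    { pairs = map swap (pairs s) ; isPartialIso = PartialIso-swap (isPartialIso s) ; ⊥₀↦⊥₀ = ∈-map⁺ swap (⊥₀↦⊥₀ s) }

  _⊑_ : Approximation → Approximation → Set
  s ⊑ s' = pairs s ⊆ pairs s'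

  Compatible : List (T × T) → T → T → Set
  Compatible ps x y = ∀ {u v} → (u , v) ∈ ps → (u ≺ x → v ≺ y) × (x ≺ u → y ≺ v)

  ∈-dom⁻ : ∀ {u} {ps : List (T × T)} → u ∈ map proj₁ ps → Σ T λ v → (u , v) ∈ ps
  ∈-dom⁻ m with ∈-map⁻ proj₁ m
  ... | (_ , v) , m' , refl = v , m'

  compatibleImage : ∀ s x → (∀ {u v} → (u , v) ∈ pairs s → u ≢ x) → Σ T (Compatible (pairs s) x)
  compatibleImage s x x∉dom = y , λ m → below m , above m
    where
    iso = isPartialIso s
    ⊥₀≺x : ⊥₀ ≺ x
    ⊥₀≺x = ⊥₀-least λ x≡⊥₀ → x∉dom (⊥₀↦⊥₀ s) (sym x≡⊥₀)
    open Σ (predecessor (∈-map⁺ proj₁ (⊥₀↦⊥₀ s)) ⊥₀≺x) renaming (proj₁ to lu; proj₂ to lu-spec)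
    lu≺x = proj₁ (proj₂ lu-spec)
    lv = proj₁ (∈-dom⁻ (proj₁ lu-spec))
    l∈ = proj₂ (∈-dom⁻ (proj₁ lu-spec))
    open Σ (justAbove (map proj₂ (pairs s)) lv) renaming (proj₁ to y; proj₂ to y-spec)
    below : ∀ {u v} → (u , v) ∈ pairs s → u ≺ x → v ≺ y
    below m u≺x with proj₂ (proj₂ lu-spec) (∈-map⁺ proj₁ m) u≺x
    ... | inj₁ refl = subst (_≺ y) (PartialIso-functional iso l∈ m) (proj₁ y-spec)
    ... | inj₂ u≺lu = ≺-trans (proj₁ (iso m l∈) u≺lu) (proj₁ y-spec)
    above : ∀ {u v} → (u , v) ∈ pairs s → x ≺ u → y ≺ v
    above m x≺u = proj₂ y-spec (∈-map⁺ proj₂ m) (proj₁ (iso l∈ m) (≺-trans lu≺x x≺u))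

  PartialIso-∷ : ∀ {ps x y} → (∀ {u v} → (u , v) ∈ ps → u ≢ x) → Compatible ps x y → PartialIso ps →
    PartialIso ((x , y) ∷ ps)
  PartialIso-∷ {ps} {x} {y} x∉dom compatible iso = λ
    { (here refl) (here refl) → (λ x≺x → ⊥-elim (≺-irrefl refl x≺x)) , (λ y≺y → ⊥-elim (≺-irrefl refl y≺y))
    ; (here refl) (there q)   → proj₂ (compatible q) , reflectAbove q
    ; (there p)   (here refl) → proj₁ (compatible p) , reflectBelow p
    ; (there p)   (there q)   → iso p q }
    where
    reflectBelow : ∀ {u v} → (u , v) ∈ ps → v ≺ y → u ≺ x
    reflectBelow m v≺y with compare _ x
    ... | tri< u≺x _ _ = u≺x
    ... | tri≈ _ u≡x _ = ⊥-elim (x∉dom m u≡x)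
    ... | tri> _ _ x≺u = ⊥-elim (≺-asym v≺y (proj₂ (compatible m) x≺u))
    reflectAbove : ∀ {u v} → (u , v) ∈ ps → y ≺ v → x ≺ u
    reflectAbove m y≺v with compare _ x
    ... | tri< u≺x _ _ = ⊥-elim (≺-asym y≺v (proj₁ (compatible m) u≺x))
    ... | tri≈ _ u≡x _ = ⊥-elim (x∉dom m u≡x)
    ... | tri> _ _ x≺u = x≺u

  PartialIso-singleton : ∀ {x y} → PartialIso ((x , y) ∷ [])
  PartialIso-singleton (here refl) (here refl) = (⊥-elim ∘ ≺-irrefl refl) , (⊥-elim ∘ ≺-irrefl refl)

  PartialIso-++ : ∀ {ps qs} → PartialIso ps → PartialIso qs →
    (∀ {u v u' v'} → (u , v) ∈ ps → (u' , v') ∈ qs → (u ≺ u' ⇔ v ≺ v') × (u' ≺ u ⇔ v' ≺ v)) →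
    PartialIso (ps ++ qs)
  PartialIso-++ {ps} ps-iso qs-iso cross m m' with ∈-++⁻ ps m | ∈-++⁻ ps m'
  ... | inj₁ p | inj₁ p' = ps-iso p p'
  ... | inj₂ q | inj₂ q' = qs-iso q q'
  ... | inj₁ p | inj₂ q  = let e = proj₁ (cross p q) in to e , from e
  ... | inj₂ q | inj₁ p  = let e = proj₂ (cross p q) in to e , from e

  domain? : ∀ x (ps : List (T × T)) → (Σ T λ y → (x , y) ∈ ps) ⊎ (∀ {u v} → (u , v) ∈ ps → u ≢ x)
  domain? x [] = inj₂ λ ()
  domain? x ((u , v) ∷ ps) with u ≟ᵀ x | domain? x ps
  ... | yes refl | _ = inj₁ (v , here refl)
  ... | no _ | inj₁ (y , m) = inj₁ (y , there m)
  ... | no u≢x | inj₂ x∉dom = inj₂ λ { (here refl) → u≢x ; (there m) → x∉dom m }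

  forth : ∀ s x → Σ Approximation λ s' → s ⊑ s' × Σ T λ y → (x , y) ∈ pairs s'
  forth s x with domain? x (pairs s)
  ... | inj₁ (y , m) = s , (λ m → m) , y , m
  ... | inj₂ x∉dom = let y , compatible = compatibleImage s x x∉dom in
    record { pairs = (x , y) ∷ pairs s
           ; isPartialIso = PartialIso-∷ x∉dom compatible (isPartialIso s)
           ; ⊥₀↦⊥₀ = there (⊥₀↦⊥₀ s) }
    , there , y , here refl

  back : ∀ s y → Σ Approximation λ s' → s ⊑ s' × Σ T λ x → (x , y) ∈ pairs s'
  back s y =
    let s' , s⁻¹⊑s' , x , m = forth (inverse s) y
    in inverse s' , (λ m → ∈-map⁺ swap (s⁻¹⊑s' (∈-map⁺ swap m))) , x , ∈-map⁺ swap m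

  Covers : Approximation → T → Set
  Covers s x = (Σ T λ y → (x , y) ∈ pairs s) × (Σ T λ u → (u , x) ∈ pairs s)

  Covers-⊑ : ∀ {s s' x} → s ⊑ s' → Covers s x → Covers s' x
  Covers-⊑ s⊑s' ((y , m) , (u , m')) = (y , s⊑s' m) , (u , s⊑s' m')

  backAndForthStep : ∀ s x → Σ Approximation λ s' → s ⊑ s' × Covers s' x
  backAndForthStep s x =
    let s₁ , s⊑s₁ , y , m₁ = forth s x
        s₂ , s₁⊑s₂ , u , m₂ = back s₁ x
    in s₂ , s₁⊑s₂ ∘ s⊑s₁ , (y , s₁⊑s₂ m₁) , (u , m₂)

  coverAll : List T → Approximation → Approximation
  coverAll [] s = s
  coverAll (x ∷ xs) s = coverAll xs (proj₁ (backAndForthStep s x))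

  coverAll-⊒ : ∀ xs s → s ⊑ coverAll xs s
  coverAll-⊒ [] s = λ m → m
  coverAll-⊒ (x ∷ xs) s = coverAll-⊒ xs _ ∘ proj₁ (proj₂ (backAndForthStep s x))

  coverAll-covers : ∀ xs s {x} → x ∈ xs → Covers (coverAll xs s) x
  coverAll-covers (x ∷ xs) s (here refl) =
    let s' , _ , covers = backAndForthStep s x in Covers-⊑ {s'} {coverAll xs s'} (coverAll-⊒ xs s') covers
  coverAll-covers (x ∷ xs) s (there x∈) = coverAll-covers xs _ x∈

  module Limit (s₀ : Approximation) where

    stage : ℕ → Approximation
    stage zero = s₀
    stage (suc n) = coverAll (enumerate n) (stage n)

    stage-mono : ∀ {m} n → m ℕ.≤ n → stage m ⊑ stage n
    stage-mono zero ℕ.z≤n = λ m → m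
    stage-mono (suc n) m≤1+n with ℕ.m≤n⇒m<n∨m≡n m≤1+n
    ... | inj₂ refl = λ m → m
    ... | inj₁ m<1+n = coverAll-⊒ (enumerate n) (stage n) ∘ stage-mono n (ℕ.≤-pred m<1+n)

    inCommonStage : ∀ {m n u v u' v'} → (u , v) ∈ pairs (stage m) → (u' , v') ∈ pairs (stage n) →
      (u , v) ∈ pairs (stage (m ⊔ n)) × (u' , v') ∈ pairs (stage (m ⊔ n))
    inCommonStage {m} {n} p q = stage-mono (m ⊔ n) (ℕ.m≤m⊔n m n) p , stage-mono (m ⊔ n) (ℕ.m≤n⊔m m n) q

    covered : ∀ x → Covers (stage (suc (proj₁ (enumerate-complete x)))) x
    covered x = let n , x∈ = enumerate-complete x in coverAll-covers (enumerate n) (stage n) x∈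

    σ σ⁻¹ : T → T
    σ x = proj₁ (proj₁ (covered x))
    σ⁻¹ y = proj₁ (proj₂ (covered y))

    x↦σx : ∀ x → (x , σ x) ∈ pairs (stage _)
    x↦σx x = proj₂ (proj₁ (covered x))

    σ⁻¹y↦y : ∀ y → (σ⁻¹ y , y) ∈ pairs (stage _)
    σ⁻¹y↦y y = proj₂ (proj₂ (covered y))

    σ⁻¹∘σ : ∀ x → σ⁻¹ (σ x) ≡ x
    σ⁻¹∘σ x = let p , q = inCommonStage (σ⁻¹y↦y (σ x)) (x↦σx x) in PartialIso-injective (isPartialIso (stage _)) p q

    σ∘σ⁻¹ : ∀ y → σ (σ⁻¹ y) ≡ y
    σ∘σ⁻¹ y = let p , q = inCommonStage (x↦σx (σ⁻¹ y)) (σ⁻¹y↦y y) in PartialIso-functional (isPartialIso (stage _)) p q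

    σ-mono : ∀ x x' → x ≺ x' ⇔ σ x ≺ σ x'
    σ-mono x x' = let p , q = inCommonStage (x↦σx x) (x↦σx x') ; iso = isPartialIso (stage _) p q in
      mk⇔ (proj₁ iso) (proj₂ iso)

    σ-extends : ∀ {u v} → (u , v) ∈ pairs s₀ → σ u ≡ v
    σ-extends m = let p , q = inCommonStage {n = 0} (x↦σx _) m in PartialIso-functional (isPartialIso (stage _)) p q

  extendToAutomorphism : ∀ ps → (⊥₀ , ⊥₀) ∈ ps → PartialIso ps →
    Σ (T ↔ T) λ σ → (∀ x x' → x ≺ x' ⇔ Inverse.to σ x ≺ Inverse.to σ x') × (∀ {u v} → (u , v) ∈ ps → Inverse.to σ u ≡ v)
  extendToAutomorphism ps ⊥₀↦⊥₀ iso = mk↔ₛ′ σ σ⁻¹ σ∘σ⁻¹ σ⁻¹∘σ , σ-mono , σ-extends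
    where
    s₀ : Approximation
    s₀ = record { pairs = ps ; isPartialIso = iso ; ⊥₀↦⊥₀ = ⊥₀↦⊥₀ }
    open Limit s₀

-- The circle cut open

integersUpTo : ℕ → List ℤ
integersUpTo n = map +_ (upTo (suc n)) ++ map -[1+_] (upTo n)

∈-integersUpTo : ∀ {z n} → ℤ.∣ z ∣ ℕ.≤ n → z ∈ integersUpTo n
∈-integersUpTo {+ k}      k≤n = ∈-++⁺ˡ (∈-map⁺ +_ (∈-upTo⁺ (ℕ.s≤s k≤n)))
∈-integersUpTo { -[1+ k ]} k<n = ∈-++⁺ʳ _ (∈-map⁺ -[1+_] (∈-upTo⁺ k<n))

enumerateℚ : ℕ → List ℚ
enumerateℚ n = cartesianProductWith (λ z d → z / suc d) (integersUpTo n) (upTo n)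

enumerateℚ-complete : ∀ p → ∃ λ n → p ∈ enumerateℚ n
enumerateℚ-complete p = n , subst (_∈ enumerateℚ n) (↥p/↧p≡p p)
  (∈-cartesianProductWith⁺ (λ z d → z / suc d)
    (∈-integersUpTo {↥ p} (ℕ.m≤m+n ℤ.∣ ↥ p ∣ (↧ₙ p))) (∈-upTo⁺ (ℕ.m≤n+m (↧ₙ p) ℤ.∣ ↥ p ∣)))
  where n = ℤ.∣ ↥ p ∣ ℕ.+ ↧ₙ p

ℚ-unbounded : ∀ x → ∃ (x <_)
ℚ-unbounded x = x + 1ℚ , subst (_< x + 1ℚ) (+-identityʳ x) (+-monoʳ-< x (positive⁻¹ 1ℚ))

fun-injective : ∀ g {x y} → fun g x ≡ fun g y → x ≡ y
fun-injective g {x} {y} gx≡gy = trans (sym (left g x)) (trans (cong (inv g) gx≡gy) (left g y))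

γ-rotate⇔ : ∀ {a b c} → γ a b c ⇔ γ b c a
γ-rotate⇔ = Cyclic-rotate⇔ _<_

γ-irrefl₁₂ : ∀ {x z} → ¬ γ x x z
γ-irrefl₁₂ = Cyclic-irrefl₁₂ _<_ (<-irrefl refl) <-asym

γ-irrefl₁₃ : ∀ {x y} → ¬ γ x y x
γ-irrefl₁₃ = Cyclic-irrefl₁₃ _<_ (<-irrefl refl) <-asym

γ-irrefl₂₃ : ∀ {x y} → ¬ γ x y y
γ-irrefl₂₃ = Cyclic-irrefl₂₃ _<_ (<-irrefl refl) <-asym

-- The circle cut open at a₀ and read from a₀ on: first [a₀, ∞), then (-∞, a₀).
module CutAt (a₀ : ℚ) where

  infix 4 _≺_
  _≺_ : ℚ → ℚ → Set
  x ≺ y = (a₀ ≤ x × y < a₀) ⊎ (x < y × (a₀ ≤ x ⊎ y < a₀))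

  side : ∀ x → a₀ ≤ x ⊎ x < a₀
  side x with a₀ ≤? x
  ... | yes a₀≤x = inj₁ a₀≤x
  ... | no a₀≰x = inj₂ (≰⇒> a₀≰x)

  ≺-irrefl : ∀ {x} → ¬ x ≺ x
  ≺-irrefl (inj₁ (a₀≤x , x<a₀)) = <-irrefl refl (<-≤-trans x<a₀ a₀≤x)
  ≺-irrefl (inj₂ (x<x , _))     = <-irrefl refl x<x

  ≺-trans : ∀ {x y z} → x ≺ y → y ≺ z → x ≺ z
  ≺-trans (inj₁ (_ , y<a₀)) (inj₁ (a₀≤y , _)) = ⊥-elim (<-irrefl refl (<-≤-trans y<a₀ a₀≤y))
  ≺-trans (inj₁ (_ , y<a₀)) (inj₂ (_ , inj₁ a₀≤y)) = ⊥-elim (<-irrefl refl (<-≤-trans y<a₀ a₀≤y))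
  ≺-trans (inj₁ (a₀≤x , _)) (inj₂ (_ , inj₂ z<a₀)) = inj₁ (a₀≤x , z<a₀)
  ≺-trans (inj₂ (_ , inj₁ a₀≤x)) (inj₁ (_ , z<a₀)) = inj₁ (a₀≤x , z<a₀)
  ≺-trans (inj₂ (_ , inj₂ y<a₀)) (inj₁ (a₀≤y , _)) = ⊥-elim (<-irrefl refl (<-≤-trans y<a₀ a₀≤y))
  ≺-trans (inj₂ (x<y , _)) (inj₂ (y<z , inj₂ z<a₀)) = inj₂ (<-trans x<y y<z , inj₂ z<a₀)
  ≺-trans (inj₂ (x<y , inj₁ a₀≤x)) (inj₂ (y<z , inj₁ _)) = inj₂ (<-trans x<y y<z , inj₁ a₀≤x)
  ≺-trans (inj₂ (_ , inj₂ y<a₀)) (inj₂ (_ , inj₁ a₀≤y)) = ⊥-elim (<-irrefl refl (<-≤-trans y<a₀ a₀≤y))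

  ≺-asym : ∀ {x y} → x ≺ y → ¬ y ≺ x
  ≺-asym x≺y y≺x = ≺-irrefl (≺-trans x≺y y≺x)

  private
    less : ∀ {x y} → x ≺ y → Tri (x ≺ y) (x ≡ y) (y ≺ x)
    less x≺y = tri< x≺y (λ { refl → ≺-irrefl x≺y }) (≺-asym x≺y)

    greater : ∀ {x y} → y ≺ x → Tri (x ≺ y) (x ≡ y) (y ≺ x)
    greater y≺x = tri> (≺-asym y≺x) (λ { refl → ≺-irrefl y≺x }) y≺x

  ≺-compare : Trichotomous _≡_ _≺_
  ≺-compare x y with <-cmp x y | side x | side y
  ... | tri≈ _ refl _ | _ | _ = tri≈ ≺-irrefl refl ≺-irrefl
  ... | tri< x<y _ _ | inj₁ a₀≤x | _         = less (inj₂ (x<y , inj₁ a₀≤x))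
  ... | tri< x<y _ _ | inj₂ _    | inj₂ y<a₀ = less (inj₂ (x<y , inj₂ y<a₀))
  ... | tri< _ _ _   | inj₂ x<a₀ | inj₁ a₀≤y = greater (inj₁ (a₀≤y , x<a₀))
  ... | tri> _ _ y<x | _         | inj₁ a₀≤y = greater (inj₂ (y<x , inj₁ a₀≤y))
  ... | tri> _ _ y<x | inj₂ x<a₀ | inj₂ _    = greater (inj₂ (y<x , inj₂ x<a₀))
  ... | tri> _ _ _   | inj₁ a₀≤x | inj₂ y<a₀ = less (inj₁ (a₀≤x , y<a₀))

  ≺-dense : ∀ {x y} → x ≺ y → ∃ λ z → x ≺ z × z ≺ y
  ≺-dense {x} (inj₁ (a₀≤x , y<a₀)) =
    let z , x<z = ℚ-unbounded x in z , inj₂ (x<z , inj₁ a₀≤x) , inj₁ (<⇒≤ (≤-<-trans a₀≤x x<z) , y<a₀)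
  ≺-dense (inj₂ (x<y , inj₁ a₀≤x)) =
    let z , x<z , z<y = <-dense x<y in z , inj₂ (x<z , inj₁ a₀≤x) , inj₂ (z<y , inj₁ (<⇒≤ (≤-<-trans a₀≤x x<z)))
  ≺-dense (inj₂ (x<y , inj₂ y<a₀)) =
    let z , x<z , z<y = <-dense x<y in z , inj₂ (x<z , inj₂ (<-trans z<y y<a₀)) , inj₂ (z<y , inj₂ y<a₀)

  ≺-isDenseLinearOrder : IsDenseLinearOrder _≡_ _≺_
  ≺-isDenseLinearOrder = record
    { isStrictTotalOrder = record
      { isStrictPartialOrder = record
        { isEquivalence = ≡.isEquivalence
        ; irrefl = λ { refl → ≺-irrefl }
        ; trans = ≺-trans
        ; <-resp-≈ = ≡.resp₂ _≺_ }
      ; compare = ≺-compare }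
    ; dense = ≺-dense }

  ≺-unbounded : ∀ x → ∃ (x ≺_)
  ≺-unbounded x with side x
  ... | inj₁ a₀≤x = let y , x<y = ℚ-unbounded x in y , inj₂ (x<y , inj₁ a₀≤x)
  ... | inj₂ x<a₀ = let y , x<y , y<a₀ = <-dense x<a₀ in y , inj₂ (x<y , inj₂ y<a₀)

  a₀-least : ∀ {y} → y ≢ a₀ → a₀ ≺ y
  a₀-least {y} y≢a₀ with <-cmp y a₀
  ... | tri< y<a₀ _ _ = inj₁ (≤-refl , y<a₀)
  ... | tri≈ _ y≡a₀ _ = ⊥-elim (y≢a₀ y≡a₀)
  ... | tri> _ _ a₀<y = inj₂ (a₀<y , inj₁ ≤-refl)

  ≮a₀ : ∀ {y} → ¬ y ≺ a₀
  ≮a₀ (inj₁ (_ , a₀<a₀))         = <-irrefl refl a₀<a₀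
  ≮a₀ (inj₂ (y<a₀ , inj₁ a₀≤y)) = <-irrefl refl (<-≤-trans y<a₀ a₀≤y)
  ≮a₀ (inj₂ (_ , inj₂ a₀<a₀))    = <-irrefl refl a₀<a₀

  private
    Above Below : ℚ → Set
    Above x = a₀ ≤ x
    Below x = x < a₀

    <⇔≺-above : ∀ {x y} → Above x → Above y → x < y ⇔ x ≺ y
    <⇔≺-above a₀≤x a₀≤y = mk⇔ (λ x<y → inj₂ (x<y , inj₁ a₀≤x))
      (λ { (inj₁ (_ , y<a₀)) → ⊥-elim (<-irrefl refl (<-≤-trans y<a₀ a₀≤y)) ; (inj₂ (x<y , _)) → x<y })

    <⇔≺-below : ∀ {x y} → Below x → Below y → x < y ⇔ x ≺ y
    <⇔≺-below x<a₀ y<a₀ = mk⇔ (λ x<y → inj₂ (x<y , inj₂ y<a₀))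
      (λ { (inj₁ (a₀≤x , _)) → ⊥-elim (<-irrefl refl (<-≤-trans x<a₀ a₀≤x)) ; (inj₂ (x<y , _)) → x<y })

    above≺below : ∀ {x y} → Above x → Below y → x ≺ y × ¬ y ≺ x
    above≺below a₀≤x y<a₀ = inj₁ (a₀≤x , y<a₀) , ≺-asym (inj₁ (a₀≤x , y<a₀))

    below<above : ∀ {x y} → Above x → Below y → y < x × ¬ x < y
    below<above a₀≤x y<a₀ = <-≤-trans y<a₀ a₀≤x , <-asym (<-≤-trans y<a₀ a₀≤x)

    γ⇔Cyclic≺-AAB : ∀ {x y z} → Above x → Above y → Below z → γ x y z ⇔ Cyclic _≺_ x y z
    γ⇔Cyclic≺-AAB ax ay bz =
      let z<x , _ = below<above ax bz ; _ , ¬y<z = below<above ay bz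
          y≺z , _ = above≺below ay bz ; _ , ¬z≺x = above≺below ax bz
      in ⇔-trans (Cyclic-reduce _<_ (inj₂ (¬y<z , z<x)))
           (⇔-trans (<⇔≺-above ax ay) (⇔-sym (Cyclic-reduce _≺_ (inj₁ (y≺z , ¬z≺x)))))

    γ⇔Cyclic≺-BBA : ∀ {x y z} → Below x → Below y → Above z → γ x y z ⇔ Cyclic _≺_ x y z
    γ⇔Cyclic≺-BBA bx by az =
      let y<z , _ = below<above az by ; _ , ¬z<x = below<above az bx
          z≺x , _ = above≺below az bx ; _ , ¬y≺z = above≺below az by
      in ⇔-trans (Cyclic-reduce _<_ (inj₁ (y<z , ¬z<x)))
           (⇔-trans (<⇔≺-below bx by) (⇔-sym (Cyclic-reduce _≺_ (inj₂ (¬y≺z , z≺x)))))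

    rotate : ∀ {x y z} → γ y z x ⇔ Cyclic _≺_ y z x → γ x y z ⇔ Cyclic _≺_ x y z
    rotate e = ⇔-trans γ-rotate⇔ (⇔-trans e (⇔-sym (Cyclic-rotate⇔ _≺_)))

  γ⇔Cyclic≺ : ∀ x y z → γ x y z ⇔ Cyclic _≺_ x y z
  γ⇔Cyclic≺ x y z with side x | side y | side z
  ... | inj₁ ax | inj₁ ay | inj₁ az = Cyclic-⇔ _<_ _≺_ (<⇔≺-above ax ay) (<⇔≺-above ay az) (<⇔≺-above az ax)
  ... | inj₂ bx | inj₂ by | inj₂ bz = Cyclic-⇔ _<_ _≺_ (<⇔≺-below bx by) (<⇔≺-below by bz) (<⇔≺-below bz bx)
  ... | inj₁ ax | inj₁ ay | inj₂ bz = γ⇔Cyclic≺-AAB ax ay bz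
  ... | inj₂ bx | inj₂ by | inj₁ az = γ⇔Cyclic≺-BBA bx by az
  ... | inj₁ ax | inj₂ by | inj₁ az = rotate (rotate (γ⇔Cyclic≺-AAB az ax by))
  ... | inj₂ bx | inj₁ ay | inj₂ bz = rotate (rotate (γ⇔Cyclic≺-BBA bz bx ay))
  ... | inj₂ bx | inj₁ ay | inj₁ az = rotate (γ⇔Cyclic≺-AAB ay az bx)
  ... | inj₁ ax | inj₂ by | inj₂ bz = rotate (γ⇔Cyclic≺-BBA by bz ax)

  γ-a₀⇔ : ∀ {u v} → γ a₀ u v ⇔ (u ≢ a₀ × u ≺ v)
  γ-a₀⇔ {u} {v} = ⇔-trans (γ⇔Cyclic≺ a₀ u v) (mk⇔ forward (λ (u≢a₀ , u≺v) → inj₁ (a₀-least u≢a₀ , u≺v)))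
    where
    forward : Cyclic _≺_ a₀ u v → u ≢ a₀ × u ≺ v
    forward (inj₁ (a₀≺u , u≺v))     = (λ { refl → ≺-irrefl a₀≺u }) , u≺v
    forward (inj₂ (inj₁ (_ , v≺a₀))) = ⊥-elim (≮a₀ v≺a₀)
    forward (inj₂ (inj₂ (v≺a₀ , _))) = ⊥-elim (≮a₀ v≺a₀)

  open BackAndForth ≺-isDenseLinearOrder ≺-unbounded a₀ a₀-least enumerateℚ enumerateℚ-complete
    using (PartialIso; PartialIso-singleton; PartialIso-++; extendToAutomorphism) public
  open DenseOrder ≺-isDenseLinearOrder ≺-unbounded using (greatest; predecessor; justAbove; flip⇔; ⇔-by-trichotomy) public

  extendToAut : ∀ ps → (a₀ , a₀) ∈ ps → PartialIso ps → Σ Aut λ h → ∀ {u v} → (u , v) ∈ ps → fun h u ≡ v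
  extendToAut ps a₀↦a₀ iso =
    let σ , σ-mono , σ-extends = extendToAutomorphism ps a₀↦a₀ iso
    in record
      { fun = Inverse.to σ ; inv = Inverse.from σ
      ; left = Inverse.strictlyInverseʳ σ ; right = Inverse.strictlyInverseˡ σ
      ; pres = λ a b c → ⇔-trans (γ⇔Cyclic≺ a b c)
          (⇔-trans (Cyclic-⇔ _≺_ _≺_ (σ-mono a b) (σ-mono b c) (σ-mono c a)) (⇔-sym (γ⇔Cyclic≺ _ _ _))) }
    , σ-extends

  Aut-≺ : ∀ g → fun g a₀ ≡ a₀ → ∀ {u v} → u ≺ v ⇔ fun g u ≺ fun g v
  Aut-≺ g ga₀≡a₀ {u} {v} = mk⇔ preserve reflect
    where
    preserve : ∀ {u v} → u ≺ v → fun g u ≺ fun g v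
    preserve {u} {v} u≺v with u ≟ a₀
    ... | yes refl = subst (_≺ fun g v) (sym ga₀≡a₀) (a₀-least gv≢a₀)
      where
      gv≢a₀ : fun g v ≢ a₀
      gv≢a₀ gv≡a₀ = ≺-irrefl (subst (a₀ ≺_) (fun-injective g (trans gv≡a₀ (sym ga₀≡a₀))) u≺v)
    ... | no u≢a₀ = proj₂ (to γ-a₀⇔ (subst (λ t → γ t _ _) ga₀≡a₀ (to (pres g a₀ u v) (from γ-a₀⇔ (u≢a₀ , u≺v)))))
    reflect : fun g u ≺ fun g v → u ≺ v
    reflect gu≺gv with ≺-compare u v
    ... | tri< u≺v _ _ = u≺v
    ... | tri≈ _ refl _ = ⊥-elim (≺-irrefl gu≺gv)
    ... | tri> _ _ v≺u = ⊥-elim (≺-asym gu≺gv (preserve v≺u))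

  SamePosition : List ℚ → ℚ → ℚ → Set
  SamePosition F x y = ∀ {a} → a ∈ F → (a ≺ x ⇔ a ≺ y) × (x ≺ a ⇔ y ≺ a)

  extendFixing : ∀ {F} → a₀ ∈ F → (moves : List (ℚ × ℚ)) → PartialIso moves →
    (∀ {x y} → (x , y) ∈ moves → SamePosition F x y) →
    Σ Aut λ h → Fixes h F × (∀ {x y} → (x , y) ∈ moves → fun h x ≡ y)
  extendFixing {F} a₀∈F moves moves-iso same =
    let h , h-extends = extendToAut (diagonal ++ moves) (∈-++⁺ˡ (∈-map⁺ (λ a → a , a) a₀∈F))
                          (PartialIso-++ diagonal-iso moves-iso cross)
    in h , (λ a a∈F → h-extends (∈-++⁺ˡ (∈-map⁺ (λ a → a , a) a∈F))) , (h-extends ∘ ∈-++⁺ʳ diagonal)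
    where
    diagonal : List (ℚ × ℚ)
    diagonal = map (λ a → a , a) F
    diagonal-iso : PartialIso diagonal
    diagonal-iso m m' with ∈-map⁻ _ m | ∈-map⁻ _ m'
    ... | _ , _ , refl | _ , _ , refl = (λ r → r) , (λ r → r)
    cross : ∀ {u v u' v'} → (u , v) ∈ diagonal → (u' , v') ∈ moves → (u ≺ u' ⇔ v ≺ v') × (u' ≺ u ⇔ v' ≺ v)
    cross m m' with ∈-map⁻ _ m
    ... | _ , a∈F , refl = same m' a∈F

  ≺⇔separated-by : ∀ {A c z} → (∃ λ a → a ∈ A × γ c a z) → c ≺ z ⇔ (∃ λ a → a ∈ A × c ≺ a × a ≺ z)
  ≺⇔separated-by {A} {c} {z} (a , a∈A , γcaz) = mk⇔ through λ (_ , _ , c≺a , a≺z) → ≺-trans c≺a a≺z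
    where
    through : c ≺ z → ∃ λ a → a ∈ A × c ≺ a × a ≺ z
    through c≺z with to (γ⇔Cyclic≺ c a z) γcaz
    ... | inj₁ (c≺a , a≺z)        = a , a∈A , c≺a , a≺z
    ... | inj₂ (inj₁ (_ , z≺c))   = ⊥-elim (≺-asym c≺z z≺c)
    ... | inj₂ (inj₂ (z≺c , _))   = ⊥-elim (≺-asym c≺z z≺c)

  Aut-≺-fixed : ∀ g → fun g a₀ ≡ a₀ → ∀ {x b} → fun g x ≡ x → (x ≺ b ⇔ x ≺ fun g b) × (b ≺ x ⇔ fun g b ≺ x)
  Aut-≺-fixed g ga₀≡a₀ {x} {b} gx≡x =
    subst (λ t → (x ≺ b ⇔ t ≺ fun g b) × (b ≺ x ⇔ fun g b ≺ t)) gx≡x (Aut-≺ g ga₀≡a₀ , Aut-≺ g ga₀≡a₀)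

  graph-PartialIso : ∀ g → fun g a₀ ≡ a₀ → ∀ B → PartialIso (map (λ b → b , fun g b) B)
  graph-PartialIso g ga₀≡a₀ B m m' with ∈-map⁻ _ m | ∈-map⁻ _ m'
  ... | _ , _ , refl | _ , _ , refl = to (Aut-≺ g ga₀≡a₀) , from (Aut-≺ g ga₀≡a₀)

  ≺-preserved-if-separated : ∀ g → fun g a₀ ≡ a₀ → ∀ {A} → Fixes g A → ∀ {b c} →
    (∃ λ a → a ∈ A × γ c a b) → (∃ λ a → a ∈ A × γ c a (fun g b)) → c ≺ b ⇔ c ≺ fun g b
  ≺-preserved-if-separated g ga₀≡a₀ {A} g-fixes {b} {c} b-sep gb-sep =
    ⇔-trans (≺⇔separated-by b-sep) (⇔-trans (mk⇔ (move to) (move from)) (⇔-sym (≺⇔separated-by gb-sep)))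
    where
    move : ∀ {y y'} → (∀ {a} → (a ≺ b ⇔ a ≺ fun g b) → a ≺ y → a ≺ y') →
      (∃ λ a → a ∈ A × c ≺ a × a ≺ y) → (∃ λ a → a ∈ A × c ≺ a × a ≺ y')
    move along (a , a∈A , c≺a , a≺y) = a , a∈A , c≺a , along (proj₁ (Aut-≺-fixed g ga₀≡a₀ (g-fixes a a∈A))) a≺y

-- The local SWIR

idAut : Aut
idAut = record { fun = λ x → x ; inv = λ x → x ; left = λ _ → refl ; right = λ _ → refl ; pres = λ _ _ _ → ⇔-refl }

infixr 9 _∘ᴬ_
_∘ᴬ_ : Aut → Aut → Aut
k ∘ᴬ g = record
  { fun = fun k ∘ fun g
  ; inv = inv g ∘ inv k
  ; left = λ x → trans (cong (inv g) (left k (fun g x))) (left g x)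
  ; right = λ y → trans (cong (fun k) (right g (inv k y))) (right k y)
  ; pres = λ a b c → ⇔-trans (pres g a b c) (pres k _ _ _) }

map-Fixes : ∀ {g X} → Fixes g X → map (fun g) X ≡ X
map-Fixes g-fixes = map-id-local (All.tabulate λ {x} x∈ → g-fixes x x∈)

γ-trans : ∀ {c x y z} → γ c x y → γ c y z → γ c x z
γ-trans {c} cxy cyz =
  let x≢c , x≺y = to γ-a₀⇔ cxy ; _ , y≺z = to γ-a₀⇔ cyz in from γ-a₀⇔ (x≢c , ≺-trans x≺y y≺z)
  where open CutAt c

infix 4 _⫫⟨_⟩_
_⫫⟨_⟩_ : List ℚ → List ℚ → List ℚ → Set
B ⫫⟨ A ⟩ C = ∀ {b c} → b ∈ B → c ∈ C → b ∉ A → c ∉ A → ∃ λ a → a ∈ A × γ c a b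

⫫-respects : ∀ {A A' B B' C C'} → SameSet A A' → SameSet B B' → SameSet C C' →
  B ⫫⟨ A ⟩ C → B' ⫫⟨ A' ⟩ C'
⫫-respects A≈A' B≈B' C≈C' B⫫C b∈ c∈ b∉ c∉ =
  let a , a∈ , γcab = B⫫C (from (B≈B' _) b∈) (from (C≈C' _) c∈) (b∉ ∘ to (A≈A' _)) (c∉ ∘ to (A≈A' _))
  in a , to (A≈A' a) a∈ , γcab

⫫-invariant : ∀ g {A B C} → B ⫫⟨ A ⟩ C → map (fun g) B ⫫⟨ map (fun g) A ⟩ map (fun g) C
⫫-invariant g B⫫C gb∈ gc∈ gb∉ gc∉ with ∈-map⁻ (fun g) gb∈ | ∈-map⁻ (fun g) gc∈
... | b , b∈ , refl | c , c∈ , refl =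
  let a , a∈ , γcab = B⫫C b∈ c∈ (gb∉ ∘ ∈-map⁺ (fun g)) (gc∉ ∘ ∈-map⁺ (fun g))
  in fun g a , ∈-map⁺ (fun g) a∈ , to (pres g c a b) γcab

⫫-monotoneˡ : ∀ {A B D C} → B ++ D ⫫⟨ A ⟩ C → B ⫫⟨ A ⟩ C × D ⫫⟨ A ++ B ⟩ C
⫫-monotoneˡ {A} {B} BD⫫C = BD⫫C ∘ ∈-++⁺ˡ , λ d∈ c∈ d∉ c∉ →
  let a , a∈ , γcad = BD⫫C (∈-++⁺ʳ B d∈) c∈ (d∉ ∘ ∈-++⁺ˡ) (c∉ ∘ ∈-++⁺ˡ) in a , ∈-++⁺ˡ a∈ , γcad

⫫-monotoneʳ : ∀ {A B C D} → B ⫫⟨ A ⟩ C ++ D → B ⫫⟨ A ⟩ C × B ⫫⟨ A ++ C ⟩ D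
⫫-monotoneʳ {A} {B} {C} B⫫CD = (λ b∈ → B⫫CD b∈ ∘ ∈-++⁺ˡ) , λ b∈ d∈ b∉ d∉ →
  let a , a∈ , γdab = B⫫CD b∈ (∈-++⁺ʳ C d∈) (b∉ ∘ ∈-++⁺ˡ) (d∉ ∘ ∈-++⁺ˡ) in a , ∈-++⁺ˡ a∈ , γdab

∉-++ : ∀ {x} {A D : List ℚ} → x ∉ A → x ∉ D → x ∉ A ++ D
∉-++ {A = A} x∉A x∉D = [ x∉A , x∉D ] ∘ ∈-++⁻ A

⫫-disjoint : ∀ {A B C c} → B ⫫⟨ A ⟩ C → c ∈ C → c ∉ A → c ∉ B
⫫-disjoint B⫫C c∈C c∉A c∈B = γ-irrefl₁₃ (proj₂ (proj₂ (B⫫C c∈B c∈C c∉A c∉A)))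

⫫-transitive : ∀ {A B C D} → D ⫫⟨ A ⟩ C → B ⫫⟨ A ++ D ⟩ C → B ++ D ⫫⟨ A ⟩ C
⫫-transitive {A} {B} {C} {D} D⫫C B⫫C {x} {c} x∈ c∈ x∉A c∉A with ∈-++⁻ B x∈ | x ∈? D
... | inj₂ x∈D | _       = D⫫C x∈D c∈ x∉A c∉A
... | inj₁ _   | yes x∈D = D⫫C x∈D c∈ x∉A c∉A
... | inj₁ x∈B | no x∉D with B⫫C x∈B c∈ (∉-++ x∉A x∉D) (∉-++ c∉A (⫫-disjoint D⫫C c∈ c∉A))
...   | a , a∈ , γcax with a ∈? A
...     | yes a∈A = a , a∈A , γcax
...     | no a∉A with ∈-++⁻ A a∈
...       | inj₁ a∈A = ⊥-elim (a∉A a∈A)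
...       | inj₂ a∈D = let a' , a'∈A , γca'a = D⫫C a∈D c∈ a∉A c∉A in a' , a'∈A , γ-trans γca'a γcax

earliestInGap : ∀ {a₀ A} → a₀ ∈ A → ∀ C {x} → x ∉ A →
  Σ ℚ λ y → CutAt.SamePosition a₀ A x y × (∀ {c} → c ∈ C → c ∉ A → ∃ λ a → a ∈ A × γ c a y)
earliestInGap {a₀} {A} a₀∈A C {x} x∉A = y , sameGap , separated
  where
  open CutAt a₀
  x≢a₀ : x ≢ a₀
  x≢a₀ refl = x∉A a₀∈A
  open Σ (predecessor a₀∈A (a₀-least x≢a₀)) renaming (proj₁ to p; proj₂ to p-spec)
  p∈A = proj₁ p-spec
  p≺x = proj₁ (proj₂ p-spec)
  open Σ (justAbove (A ++ C) p) renaming (proj₁ to y; proj₂ to y-spec)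
  p≺y = proj₁ y-spec
  y-below : ∀ {s} → s ∈ A ++ C → p ≺ s → y ≺ s
  y-below = proj₂ y-spec
  below : ∀ {a} → a ∈ A → a ≺ x → a ≺ y
  below a∈A a≺x with proj₂ (proj₂ p-spec) a∈A a≺x
  ... | inj₁ refl = p≺y
  ... | inj₂ a≺p = ≺-trans a≺p p≺y
  above : ∀ {a} → a ∈ A → x ≺ a → y ≺ a
  above a∈A x≺a = y-below (∈-++⁺ˡ a∈A) (≺-trans p≺x x≺a)
  sameGap : SamePosition A x y
  sameGap {a} a∈A = let a≺x⇔a≺y = ⇔-by-trichotomy x≢a y≢a (below a∈A) (above a∈A) in
    a≺x⇔a≺y , flip⇔ x≢a y≢a a≺x⇔a≺y
    where
    x≢a : x ≢ a
    x≢a refl = x∉A a∈A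
    y≢a : y ≢ a
    y≢a refl = ≺-irrefl (y-below (∈-++⁺ˡ a∈A) p≺y)
  separated : ∀ {c} → c ∈ C → c ∉ A → ∃ λ a → a ∈ A × γ c a y
  separated {c} c∈C c∉A with ≺-compare c y
  ... | tri≈ _ refl _ = ⊥-elim (≺-irrefl (y-below (∈-++⁺ʳ A c∈C) p≺y))
  ... | tri> _ _ y≺c = a₀ , a₀∈A , from γ-rotate⇔ (from γ-a₀⇔ (y≢a₀ , y≺c))
    where
    y≢a₀ : y ≢ a₀
    y≢a₀ y≡a₀ = ≮a₀ (subst (p ≺_) y≡a₀ p≺y)
  ... | tri< c≺y _ _ with ≺-compare c p
  ...   | tri< c≺p _ _ = p , p∈A , from (γ⇔Cyclic≺ c p y) (inj₁ (c≺p , p≺y))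
  ...   | tri≈ _ refl _ = ⊥-elim (c∉A p∈A)
  ...   | tri> _ _ p≺c = ⊥-elim (≺-asym c≺y (y-below (∈-++⁺ʳ A c∈C) p≺c))

onePoint : ∀ {a₀ A} → a₀ ∈ A → ∀ C x → Σ Aut λ k → Fixes k A × fun k x ∷ [] ⫫⟨ A ⟩ C
onePoint {a₀} {A} a₀∈A C x with x ∈? A
... | yes x∈A = idAut , (λ _ _ → refl) , λ { (here refl) _ x∉A _ → ⊥-elim (x∉A x∈A) }
... | no x∉A =
  let y , x≈y , y-separated = earliestInGap a₀∈A C x∉A
      k , k-fixes , k-moves = CutAt.extendFixing a₀ a₀∈A ((x , y) ∷ []) (CutAt.PartialIso-singleton a₀) λ { (here refl) → x≈y }
  in k , k-fixes , λ { (here refl) c∈C _ c∉A →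
       subst (λ z → ∃ λ a → a ∈ A × γ _ a z) (sym (k-moves (here refl))) (y-separated c∈C c∉A) }

existenceˡ : ∀ {a₀ A} → a₀ ∈ A → ∀ B C → Σ Aut λ g → Fixes g A × map (fun g) B ⫫⟨ A ⟩ C
existenceˡ a₀∈A [] C = idAut , (λ _ _ → refl) , λ ()
existenceˡ {A = A} a₀∈A (b ∷ B) C =
  let g , g-fixes , gB⫫C = existenceˡ a₀∈A B C
      k , k-fixes , kgb⫫C = onePoint (∈-++⁺ˡ {ys = map (fun g) B} a₀∈A) C (fun g b)
      kgB≡gB : map (fun (k ∘ᴬ g)) B ≡ map (fun g) B
      kgB≡gB = trans (map-∘ B) (map-Fixes {k} (λ x x∈ → k-fixes x (∈-++⁺ʳ A x∈)))
  in k ∘ᴬ g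
   , (λ a a∈A → trans (cong (fun k) (g-fixes a a∈A)) (k-fixes a (∈-++⁺ˡ a∈A)))
   , subst (λ kgB → fun k (fun g b) ∷ kgB ⫫⟨ A ⟩ C) (sym kgB≡gB) (⫫-transitive gB⫫C kgb⫫C)

stationarityˡ : ∀ A B B' C → NonEmpty A → B ⫫⟨ A ⟩ C → B' ⫫⟨ A ⟩ C →
  (g : Aut) → Fixes g A → SameSet (map (fun g) B) B' →
  Σ Aut λ h → Fixes h (A ++ C) × (∀ x → x ∈ B → fun h x ≡ fun g x)
stationarityˡ A B B' C (a₀ , a₀∈A) B⫫C B'⫫C g g-fixes gB≈B' =
  let h , h-fixes , h-moves = extendFixing (∈-++⁺ˡ a₀∈A) (map (λ b → b , fun g b) B) (graph-PartialIso g ga₀≡a₀ B)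
        λ m → case ∈-map⁻ _ m of λ { (_ , b∈B , refl) → samePosition b∈B }
  in h , h-fixes , λ x x∈B → h-moves (∈-map⁺ (λ b → b , fun g b) x∈B)
  where
  open CutAt a₀
  ga₀≡a₀ = g-fixes a₀ a₀∈A
  samePosition : ∀ {b} → b ∈ B → SamePosition (A ++ C) b (fun g b)
  samePosition {b} b∈B {c} c∈AC with c ∈? A | b ∈? A
  ... | yes c∈A | _ = Aut-≺-fixed g ga₀≡a₀ (g-fixes c c∈A)
  ... | no _ | yes b∈A = subst (λ t → (c ≺ b ⇔ c ≺ t) × (b ≺ c ⇔ t ≺ c)) (sym (g-fixes b b∈A)) (⇔-refl , ⇔-refl)
  ... | no c∉A | no b∉A =
    let c∈C = [ ⊥-elim ∘ c∉A , (λ c∈C → c∈C) ] (∈-++⁻ A c∈AC)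
        gb∈B' = to (gB≈B' _) (∈-map⁺ (fun g) b∈B)
        gb∉A = λ gb∈A → b∉A (subst (_∈ A) (fun-injective g (g-fixes _ gb∈A)) gb∈A)
        c≺b⇔c≺gb = ≺-preserved-if-separated g ga₀≡a₀ g-fixes (B⫫C b∈B c∈C b∉A c∉A) (B'⫫C gb∈B' c∈C gb∉A c∉A)
    in c≺b⇔c≺gb
     , flip⇔ (λ { refl → ⫫-disjoint B⫫C c∈C c∉A b∈B }) (λ { refl → ⫫-disjoint B'⫫C c∈C c∉A gb∈B' }) c≺b⇔c≺gb

γ-mirror : ∀ {a b c} → γ a b c → γ (- c) (- b) (- a)
γ-mirror (inj₁ (a<b , b<c))        = inj₁ (neg-antimono-< b<c , neg-antimono-< a<b)
γ-mirror (inj₂ (inj₁ (b<c , c<a))) = inj₂ (inj₂ (neg-antimono-< c<a , neg-antimono-< b<c))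
γ-mirror (inj₂ (inj₂ (c<a , a<b))) = inj₂ (inj₁ (neg-antimono-< a<b , neg-antimono-< c<a))

γ-mirror⇔ : ∀ {a b c} → γ a b c ⇔ γ (- c) (- b) (- a)
γ-mirror⇔ {a} {b} {c} = mk⇔ γ-mirror unmirror
  where
  unmirror : γ (- c) (- b) (- a) → γ a b c
  unmirror γ-c-b-a with γ-mirror γ-c-b-a
  ... | γ--a--b--c rewrite neg-involutive a | neg-involutive b | neg-involutive c = γ--a--b--c

mirror : Aut → Aut
mirror g = record
  { fun = λ x → - fun g (- x)
  ; inv = λ y → - inv g (- y)
  ; left = λ x → trans (cong (λ t → - inv g t) (neg-involutive _)) (trans (cong -_ (left g (- x))) (neg-involutive x))
  ; right = λ y → trans (cong (λ t → - fun g t) (neg-involutive _)) (trans (cong -_ (right g (- y))) (neg-involutive y))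
  ; pres = λ a b c → ⇔-trans γ-mirror⇔ (⇔-trans (pres g _ _ _) γ-mirror⇔) }

mirror-agrees : ∀ g {x y} → fun g (- x) ≡ - y → fun (mirror g) x ≡ y
mirror-agrees g {x} {y} g-x≡-y = trans (cong -_ g-x≡-y) (neg-involutive y)

∈-map-neg⁻ : ∀ {x X} → x ∈ map -_ X → - x ∈ X
∈-map-neg⁻ {X = X} m with ∈-map⁻ -_ m
... | x , x∈ , refl = subst (_∈ X) (sym (neg-involutive x)) x∈

Fixes-mirror : ∀ {g X} → Fixes g (map -_ X) → Fixes (mirror g) X
Fixes-mirror {g} g-fixes x x∈ = mirror-agrees g (g-fixes (- x) (∈-map⁺ -_ x∈))

map-neg-involutive : ∀ X → map -_ (map -_ X) ≡ X
map-neg-involutive X = trans (sym (map-∘ X)) (map-id-local (All.tabulate λ {x} _ → neg-involutive x))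

∈-map-neg⁺ : ∀ {x X} → - x ∈ X → x ∈ map -_ X
∈-map-neg⁺ {x} -x∈ = subst (_∈ _) (neg-involutive x) (∈-map⁺ -_ -x∈)

⫫-mirror : ∀ {A B C} → B ⫫⟨ A ⟩ C → map -_ C ⫫⟨ map -_ A ⟩ map -_ B
⫫-mirror B⫫C {c'} {b'} c'∈ b'∈ c'∉ b'∉ =
  let a , a∈A , γ-c'a-b' = B⫫C (∈-map-neg⁻ b'∈) (∈-map-neg⁻ c'∈) (b'∉ ∘ ∈-map-neg⁺) (c'∉ ∘ ∈-map-neg⁺)
  in - a , ∈-map⁺ -_ a∈A , from γ-mirror⇔ (subst (λ t → γ (- c') t (- b')) (sym (neg-involutive a)) γ-c'a-b')

map-mirror : ∀ g X → map (fun (mirror g)) X ≡ map -_ (map (fun g) (map -_ X))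
map-mirror g X = trans (map-∘ X) (cong (map -_) (map-∘ X))

≡⇒SameSet : ∀ {X Y} → X ≡ Y → SameSet X Y
≡⇒SameSet refl _ = ⇔-refl

SameSet-map : ∀ (f : ℚ → ℚ) {X Y} → SameSet X Y → SameSet (map f X) (map f Y)
SameSet-map f X≈Y y = mk⇔ (transport (to (X≈Y _))) (transport (from (X≈Y _)))
  where
  transport : ∀ {X Y} → (∀ {x} → x ∈ X → x ∈ Y) → y ∈ map f X → y ∈ map f Y
  transport X⊆Y y∈ with ∈-map⁻ f y∈
  ... | x , x∈ , refl = ∈-map⁺ f (X⊆Y x∈)

existenceʳ : ∀ {a₀ A} → a₀ ∈ A → ∀ B C → Σ Aut λ h → Fixes h A × B ⫫⟨ A ⟩ map (fun h) C
existenceʳ {A = A} a₀∈A B C =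
  let g , g-fixes , gC⫫B = existenceˡ (∈-map⁺ -_ a₀∈A) (map -_ C) (map -_ B)
  in mirror g , Fixes-mirror {g} {A} g-fixes
   , ⫫-respects (≡⇒SameSet (map-neg-involutive A)) (≡⇒SameSet (map-neg-involutive B))
       (≡⇒SameSet (sym (map-mirror g C))) (⫫-mirror gC⫫B)

stationarityʳ : ∀ A B C C' → NonEmpty A → B ⫫⟨ A ⟩ C → B ⫫⟨ A ⟩ C' →
  (g : Aut) → Fixes g A → SameSet (map (fun g) C) C' →
  Σ Aut λ h → Fixes h (A ++ B) × (∀ x → x ∈ C → fun h x ≡ fun g x)
stationarityʳ A B C C' (a₀ , a₀∈A) B⫫C B⫫C' g g-fixes gC≈C' =
  let h , h-fixes , h-agrees = stationarityˡ (map -_ A) (map -_ C) (map -_ C') (map -_ B)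
        (- a₀ , ∈-map⁺ -_ a₀∈A) (⫫-mirror B⫫C) (⫫-mirror B⫫C') (mirror g) mirror-g-fixes mirror-gC≈C'
  in mirror h , Fixes-mirror {h} {A ++ B} (subst (Fixes h) (sym (map-++ -_ A B)) h-fixes)
   , λ x x∈C → mirror-agrees h {x} {fun g x} (trans (h-agrees (- x) (∈-map⁺ -_ x∈C)) (cong (λ t → - fun g t) (neg-involutive x)))
  where
  mirror-g-fixes : Fixes (mirror g) (map -_ A)
  mirror-g-fixes = Fixes-mirror {g} {map -_ A} (subst (Fixes g) (sym (map-neg-involutive A)) g-fixes)
  mirror-gC≈C' : SameSet (map (fun (mirror g)) (map -_ C)) (map -_ C')
  mirror-gC≈C' = subst (λ X → SameSet X (map -_ C'))
    (sym (trans (map-mirror g (map -_ C)) (cong (map -_ ∘ map (fun g)) (map-neg-involutive C))))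
    (SameSet-map -_ gC≈C')

localSWIR : LocalSWIR
localSWIR = record
  { ind = λ B A C → B ⫫⟨ A ⟩ C
  ; respects = λ _ → ⫫-respects
  ; invariance = λ g A B C _ → ⫫-invariant g
  ; existenceˡ = λ A B C (_ , a₀∈A) → existenceˡ a₀∈A B C
  ; existenceʳ = λ A B C (_ , a₀∈A) → existenceʳ a₀∈A B C
  ; stationarityˡ = stationarityˡ
  ; stationarityʳ = stationarityʳ
  ; monotonicityˡ = λ A B D C _ → ⫫-monotoneˡ
  ; monotonicityʳ = λ A B C D _ → ⫫-monotoneʳ
  }

-- The Katětov functor

infix 4 _<ₗ_
_<ₗ_ : ℚ × Bool → ℚ × Bool → Set
_<ₗ_ = ×-Lex _≡_ _<_ Bool._<_

<ₗ-irrefl : ∀ {x} → ¬ x <ₗ x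
<ₗ-irrefl = ×-irreflexive {_≈₁_ = _≡_} {_<₁_ = _<_} {_≈₂_ = _≡_} {_<₂_ = Bool._<_} <-irrefl Bool.<-irrefl (refl , refl)

<ₗ-asym : Asymmetric _<ₗ_
<ₗ-asym = ×-asymmetric {_≈₁_ = _≡_} {_<₁_ = _<_} {_<₂_ = Bool._<_} sym (≡.resp₂ _<_) <-asym Bool.<-asym

<ₗ-compare : Trichotomous _≡_ _<ₗ_
<ₗ-compare x y with ×-compare {_≈₁_ = _≡_} {_<₁_ = _<_} {_≈₂_ = _≡_} {_<₂_ = Bool._<_} sym <-cmp Bool.<-cmp x y
... | tri< x<y x≉y x≯y = tri< x<y (x≉y ∘ ≡⇒≡×≡) x≯y
... | tri≈ x≮y x≈y x≯y = tri≈ x≮y (≡×≡⇒≡ x≈y) x≯y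
... | tri> x≮y x≉y x>y = tri> x≮y (x≉y ∘ ≡⇒≡×≡) x>y

-- The cyclic order of ℚ × Bool read lexicographically: (q , true) is a point right after q.
CL : ℚ × Bool → ℚ × Bool → ℚ × Bool → Set
CL = Cyclic _<ₗ_

CL-irrefl₁₂ : ∀ {x z} → ¬ CL x x z
CL-irrefl₁₂ = Cyclic-irrefl₁₂ _<ₗ_ <ₗ-irrefl <ₗ-asym

CL-irrefl₂₃ : ∀ {x y} → ¬ CL x y y
CL-irrefl₂₃ = Cyclic-irrefl₂₃ _<ₗ_ <ₗ-irrefl <ₗ-asym

CL-irrefl₁₃ : ∀ {x y} → ¬ CL x y x
CL-irrefl₁₃ = Cyclic-irrefl₁₃ _<ₗ_ <ₗ-irrefl <ₗ-asym

<ₗ⇔<-distinct : ∀ {p q i j} → p ≢ q → (p , i) <ₗ (q , j) ⇔ p < q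
<ₗ⇔<-distinct p≢q = mk⇔ (λ { (inj₁ p<q) → p<q ; (inj₂ (p≡q , _)) → ⊥-elim (p≢q p≡q) }) inj₁

<ₗ⇔<-equal : ∀ {p i j} → (p , i) <ₗ (p , j) ⇔ i Bool.< j
<ₗ⇔<-equal = mk⇔ (λ { (inj₁ p<p) → ⊥-elim (<-irrefl refl p<p) ; (inj₂ (_ , i<j)) → i<j }) (λ i<j → inj₂ (refl , i<j))

<ₗ⇔<-false : ∀ {p q} → (p , false) <ₗ (q , false) ⇔ p < q
<ₗ⇔<-false = mk⇔ (λ { (inj₁ p<q) → p<q ; (inj₂ (_ , ())) }) inj₁

CL⇔γ-false : ∀ {p q r} → CL (p , false) (q , false) (r , false) ⇔ γ p q r
CL⇔γ-false = Cyclic-⇔ _<ₗ_ _<_ <ₗ⇔<-false <ₗ⇔<-false <ₗ⇔<-false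

CL⇔γ-distinct : ∀ {p q r i j k} → p ≢ q → q ≢ r → r ≢ p → CL (p , i) (q , j) (r , k) ⇔ γ p q r
CL⇔γ-distinct p≢q q≢r r≢p = Cyclic-⇔ _<ₗ_ _<_ (<ₗ⇔<-distinct p≢q) (<ₗ⇔<-distinct q≢r) (<ₗ⇔<-distinct r≢p)

CL⇔<-equal₁₂ : ∀ {p r i j k} → p ≢ r → CL (p , i) (p , j) (r , k) ⇔ i Bool.< j
CL⇔<-equal₁₂ {p} {r} {i} {j} {k} p≢r = mk⇔ to' from'
  where
  to' : CL (p , i) (p , j) (r , k) → i Bool.< j
  to' (inj₁ (i<j , _))              = to <ₗ⇔<-equal i<j
  to' (inj₂ (inj₁ (p<r , r<p)))     = ⊥-elim (<-asym (to (<ₗ⇔<-distinct p≢r) p<r) (to (<ₗ⇔<-distinct (p≢r ∘ sym)) r<p))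
  to' (inj₂ (inj₂ (_ , i<j)))       = to <ₗ⇔<-equal i<j
  from' : i Bool.< j → CL (p , i) (p , j) (r , k)
  from' i<j with <-cmp p r
  ... | tri< p<r _ _ = inj₁ (from <ₗ⇔<-equal i<j , inj₁ p<r)
  ... | tri≈ _ p≡r _ = ⊥-elim (p≢r p≡r)
  ... | tri> _ _ r<p = inj₂ (inj₂ (inj₁ r<p , from <ₗ⇔<-equal i<j))

CL⇔<-equal₂₃ : ∀ {p q i j k} → q ≢ p → CL (p , i) (q , j) (q , k) ⇔ j Bool.< k
CL⇔<-equal₂₃ q≢p = ⇔-trans (Cyclic-rotate⇔ _<ₗ_) (CL⇔<-equal₁₂ q≢p)

CL⇔<-equal₃₁ : ∀ {p q i j k} → p ≢ q → CL (p , i) (q , j) (p , k) ⇔ k Bool.< i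
CL⇔<-equal₃₁ p≢q = ⇔-trans (⇔-sym (Cyclic-rotate⇔ _<ₗ_)) (CL⇔<-equal₁₂ p≢q)

Bool-<-chain : ∀ {i j k} → i Bool.< j → ¬ j Bool.< k
Bool-<-chain Bool.f<t ()

¬CL-equal : ∀ {p i j k} → ¬ CL (p , i) (p , j) (p , k)
¬CL-equal (inj₁ (i<j , j<k))        = Bool-<-chain (to <ₗ⇔<-equal i<j) (to <ₗ⇔<-equal j<k)
¬CL-equal (inj₂ (inj₁ (j<k , k<i))) = Bool-<-chain (to <ₗ⇔<-equal j<k) (to <ₗ⇔<-equal k<i)
¬CL-equal (inj₂ (inj₂ (k<i , i<j))) = Bool-<-chain (to <ₗ⇔<-equal k<i) (to <ₗ⇔<-equal i<j)

lift : ∀ {T : Set} → (T → ℚ) → T × Bool → ℚ × Bool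
lift u (a , i) = u a , i

γ-transfer : ∀ {X} (u v : Emb X ℚγ) a b c → γ (emb u a) (emb u b) (emb u c) ⇔ γ (emb v a) (emb v b) (emb v c)
γ-transfer u v a b c = ⇔-trans (⇔-sym (pres u a b c)) (pres v a b c)

≢-transfer : ∀ {X} (u v : Emb X ℚγ) {a b} → emb u a ≢ emb u b → emb v a ≢ emb v b
≢-transfer u v ua≢ub va≡vb = ua≢ub (cong (emb u) (inj v va≡vb))

-- CL on lifted points only sees which base points coincide and how they are cyclically ordered.
CL-lift-transfer : ∀ {X} (u v : Emb X ℚγ) (x y z : Carrier X × Bool) →
  CL (lift (emb u) x) (lift (emb u) y) (lift (emb u) z) ⇔ CL (lift (emb v) x) (lift (emb v) y) (lift (emb v) z)
CL-lift-transfer u v (a , i) (b , j) (c , k) with emb u a ≟ emb u b | emb u b ≟ emb u c | emb u c ≟ emb u a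
... | yes ua≡ub | yes ub≡uc | _ with inj u ua≡ub | inj u ub≡uc
...   | refl | refl = mk⇔ (⊥-elim ∘ ¬CL-equal) (⊥-elim ∘ ¬CL-equal)
CL-lift-transfer u v (a , i) (b , j) (c , k) | yes ua≡ub | no ub≢uc | _ with inj u ua≡ub
...   | refl = ⇔-trans (CL⇔<-equal₁₂ ub≢uc) (⇔-sym (CL⇔<-equal₁₂ (≢-transfer u v ub≢uc)))
CL-lift-transfer u v (a , i) (b , j) (c , k) | no ua≢ub | yes ub≡uc | _ with inj u ub≡uc
...   | refl = ⇔-trans (CL⇔<-equal₂₃ (ua≢ub ∘ sym)) (⇔-sym (CL⇔<-equal₂₃ (≢-transfer u v (ua≢ub ∘ sym))))
CL-lift-transfer u v (a , i) (b , j) (c , k) | no ua≢ub | no _ | yes uc≡ua with inj u uc≡ua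
...   | refl = ⇔-trans (CL⇔<-equal₃₁ ua≢ub) (⇔-sym (CL⇔<-equal₃₁ (≢-transfer u v ua≢ub)))
CL-lift-transfer u v (a , i) (b , j) (c , k) | no ua≢ub | no ub≢uc | no uc≢ua =
  ⇔-trans (CL⇔γ-distinct ua≢ub ub≢uc uc≢ua)
    (⇔-trans (γ-transfer u v a b c)
      (⇔-sym (CL⇔γ-distinct (≢-transfer u v ua≢ub) (≢-transfer u v ub≢uc) (≢-transfer u v uc≢ua))))

-- When P is the last of the points considered before E (in the order cut at E),
-- E sits where (P , true) does.
module _ (E P : ℚ) where
  open CutAt E

  private
    below-P : ∀ {X} → X ≢ P → ¬ P ≺ X → X ≺ P
    below-P {X} X≢P P⊀X with ≺-compare X P
    ... | tri< X≺P _ _ = X≺P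
    ... | tri≈ _ X≡P _ = ⊥-elim (X≢P X≡P)
    ... | tri> _ _ P≺X = ⊥-elim (P⊀X P≺X)

    ≺⇔CL-after-P : ∀ {Y Z} → ¬ P ≺ Y → ¬ P ≺ Z → Y ≺ Z ⇔ CL (P , true) (Y , false) (Z , false)
    ≺⇔CL-after-P {Y} {Z} P⊀Y P⊀Z with Y ≟ Z | P ≟ Y | P ≟ Z
    ... | yes refl | _ | _ = mk⇔ (⊥-elim ∘ ≺-irrefl) (⊥-elim ∘ CL-irrefl₂₃)
    ... | no Y≢Z | yes refl | _ = mk⇔ (⊥-elim ∘ P⊀Z) (λ cl → case to (CL⇔<-equal₁₂ Y≢Z) cl of λ ())
    ... | no Y≢Z | no P≢Y | yes refl =
      mk⇔ (λ _ → from (CL⇔<-equal₃₁ P≢Y) Bool.f<t) (λ _ → below-P (P≢Y ∘ sym) P⊀Y)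
    ... | no Y≢Z | no P≢Y | no P≢Z =
      ⇔-sym (⇔-trans (CL⇔γ-distinct P≢Y Y≢Z (P≢Z ∘ sym)) (⇔-trans (γ⇔Cyclic≺ P Y Z)
        (⇔-trans (Cyclic-rotate⇔ _≺_) (Cyclic-reduce _≺_ (inj₁ (below-P (P≢Z ∘ sym) P⊀Z , P⊀Y))))))

  γ-E⇔CL-after-P : ∀ {Y Z} → Y ≢ E → ¬ P ≺ Y → ¬ P ≺ Z → γ E Y Z ⇔ CL (P , true) (Y , false) (Z , false)
  γ-E⇔CL-after-P Y≢E P⊀Y P⊀Z = ⇔-trans (⇔-trans γ-a₀⇔ (mk⇔ proj₂ (Y≢E ,_))) (≺⇔CL-after-P P⊀Y P⊀Z)

module ℚ-order = DenseOrder <-isDenseLinearOrder ℚ-unbounded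

elements : (A : FinObj) → List (Carrier (FinObj.str A))
elements A = let n , iso = FinObj.finite A in map (Inverse.from iso) (allFin n)

∈-elements : ∀ A a → a ∈ elements A
∈-elements A a = let n , iso = FinObj.finite A in
  subst (_∈ elements A) (Inverse.strictlyInverseʳ iso a) (∈-map⁺ (Inverse.from iso) (∈-allFin (Inverse.to iso a)))

module Katetov (A : FinObj) where

  private
    X = FinObj.str A
    eA = FinObj.embM A
    ea = emb eA

  KStr : Str
  KStr = record { Carrier = Carrier X × Bool ; R = λ x y z → CL (lift ea x) (lift ea y) (lift ea z) }

  private
    justAfter : ∀ a → Σ ℚ λ q → ea a < q × (∀ {s} → s ∈ map ea (elements A) → ea a < s → q < s)
    justAfter a = ℚ-order.justAbove (map ea (elements A)) (ea a)

  toℚ : Carrier X × Bool → ℚ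
  toℚ (a , false) = ea a
  toℚ (a , true)  = proj₁ (justAfter a)

  private
    toℚ-before : ∀ a i b → ea a < ea b → toℚ (a , i) < ea b
    toℚ-before a false b a<b = a<b
    toℚ-before a true  b a<b = proj₂ (proj₂ (justAfter a)) (∈-map⁺ ea (∈-elements A b)) a<b

    toℚ-after : ∀ b j → ea b ≤ toℚ (b , j)
    toℚ-after b false = ≤-refl
    toℚ-after b true  = <⇒≤ (proj₁ (proj₂ (justAfter b)))

  toℚ-mono : ∀ x y → lift ea x <ₗ lift ea y → toℚ x < toℚ y
  toℚ-mono (a , i) (b , j) (inj₁ a<b) = <-≤-trans (toℚ-before a i b a<b) (toℚ-after b j)
  toℚ-mono (a , false) (b , true) (inj₂ (a≡b , Bool.f<t)) = subst (_< toℚ (b , true)) (sym a≡b) (proj₁ (proj₂ (justAfter b)))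

  lift-injective : ∀ {x y} → lift ea x ≡ lift ea y → x ≡ y
  lift-injective {a , i} {b , j} eq = cong₂ _,_ (inj eA (cong proj₁ eq)) (cong proj₂ eq)

  toℚ-reflects : ∀ x y → toℚ x < toℚ y → lift ea x <ₗ lift ea y
  toℚ-reflects x y x<y with <ₗ-compare (lift ea x) (lift ea y)
  ... | tri< x<ₗy _ _ = x<ₗy
  ... | tri≈ _ x≡y _ = ⊥-elim (<-irrefl (cong toℚ (lift-injective x≡y)) x<y)
  ... | tri> _ _ y<ₗx = ⊥-elim (<-asym x<y (toℚ-mono y x y<ₗx))

  toℚ-injective : ∀ {x y} → toℚ x ≡ toℚ y → x ≡ y
  toℚ-injective {x} {y} eq with <ₗ-compare (lift ea x) (lift ea y)
  ... | tri< x<ₗy _ _ = ⊥-elim (<-irrefl eq (toℚ-mono x y x<ₗy))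
  ... | tri≈ _ x≡y _ = lift-injective x≡y
  ... | tri> _ _ y<ₗx = ⊥-elim (<-irrefl (sym eq) (toℚ-mono y x y<ₗx))

  toℚ-emb : Emb KStr ℚγ
  toℚ-emb = record
    { emb = toℚ
    ; inj = toℚ-injective
    ; pres = λ x y z → let ⇔< x y = mk⇔ (toℚ-mono x y) (toℚ-reflects x y) in Cyclic-⇔ _<ₗ_ _<_ (⇔< x y) (⇔< y z) (⇔< z x) }

  private
    index : Carrier X → Fin (proj₁ (FinObj.finite A))
    index = Inverse.to (proj₂ (FinObj.finite A))

  code : Carrier X × Bool → ℕ
  code (a , i) = toℕ (combine (index a) (Inverse.from 2↔Bool i))

  code-injective : ∀ {x y} → code x ≡ code y → x ≡ y
  code-injective {a , i} {b , j} eq =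
    let a≡b , i≡j = combine-injective (index a) _ (index b) _ (toℕ-injective eq)
    in cong₂ _,_ (Injection.injective (↔⇒↣ (proj₂ (FinObj.finite A))) a≡b) (Injection.injective (↔⇒↣ (↔-sym 2↔Bool)) i≡j)

  K₀ : CtblObj
  K₀ = record { str = KStr ; countable = code , code-injective ; nonempty = FinObj.nonempty A , false ; embM = toℚ-emb }

  η : Emb X KStr
  η = record
    { emb = λ a → a , false
    ; inj = cong proj₁
    ; pres = λ a b c → ⇔-trans (pres eA a b c) (⇔-sym CL⇔γ-false) }

K₁ : ∀ {A B} → Emb (FinObj.str A) (FinObj.str B) → Emb (Katetov.KStr A) (Katetov.KStr B)
K₁ {A} {B} f = record
  { emb = λ x → emb f (proj₁ x) , proj₂ x
  ; inj = λ eq → cong₂ _,_ (inj f (cong proj₁ eq)) (cong proj₂ eq)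
  ; pres = CL-lift-transfer (FinObj.embM A) (FinObj.embM B ∘ₑ f) }

module OnePointRealisation {A B : FinObj} (ζ : Emb (FinObj.str A) (FinObj.str B)) (ext : OnePointExt ζ) where

  private
    eB = FinObj.embM B
    e = proj₁ ext
    cover = proj₁ (proj₂ ext)
    e∉ζ = proj₂ (proj₂ ext)
    E = emb eB e
    old : Carrier (FinObj.str A) → ℚ
    old = emb (eB ∘ₑ ζ)

  open CutAt E

  private
    last = greatest old (∈-elements A (FinObj.nonempty A))
    p = proj₁ last
    P = old p

    P⊀old : ∀ a → ¬ P ≺ old a
    P⊀old a = proj₂ (proj₂ last) (∈-elements A a)

    old≢E : ∀ a → old a ≢ E
    old≢E a eq = e∉ζ a (inj eB eq)

  realise : Carrier (FinObj.str B) → Carrier (FinObj.str A) × Bool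
  realise b with cover b
  ... | inj₁ _ = p , true
  ... | inj₂ (a , _) = a , false

  realise-old : ∀ a → realise (emb ζ a) ≡ (a , false)
  realise-old a with cover (emb ζ a)
  ... | inj₁ ζa≡e = ⊥-elim (e∉ζ a ζa≡e)
  ... | inj₂ (a' , ζa'≡ζa) = cong (_, false) (inj ζ ζa'≡ζa)

  private
    unrealise : Carrier (FinObj.str A) × Bool → Carrier (FinObj.str B)
    unrealise (a , false) = emb ζ a
    unrealise (_ , true)  = e

    unrealise∘realise : ∀ b → unrealise (realise b) ≡ b
    unrealise∘realise b with cover b
    ... | inj₁ refl = refl
    ... | inj₂ (_ , refl) = refl

  realise-injective : ∀ {x y} → realise x ≡ realise y → x ≡ y
  realise-injective {x} {y} eq = trans (sym (unrealise∘realise x)) (trans (cong unrealise eq) (unrealise∘realise y))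

  private
    placed : Carrier (FinObj.str B) → ℚ × Bool
    placed b = lift old (realise b)

  γ⇔CL-placed : ∀ x y w → γ (emb eB x) (emb eB y) (emb eB w) ⇔ CL (placed x) (placed y) (placed w)
  γ⇔CL-placed x y w with cover x | cover y | cover w
  ... | inj₂ (a , refl) | inj₂ (b , refl) | inj₂ (c , refl) = ⇔-sym CL⇔γ-false
  ... | inj₁ refl | inj₂ (b , refl) | inj₂ (c , refl) = γ-E⇔CL-after-P E P (old≢E b) (P⊀old b) (P⊀old c)
  ... | inj₂ (a , refl) | inj₁ refl | inj₂ (c , refl) =
    ⇔-trans γ-rotate⇔ (⇔-trans (γ-E⇔CL-after-P E P (old≢E c) (P⊀old c) (P⊀old a)) (⇔-sym (Cyclic-rotate⇔ _<ₗ_)))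
  ... | inj₂ (a , refl) | inj₂ (b , refl) | inj₁ refl =
    ⇔-trans (⇔-sym γ-rotate⇔) (⇔-trans (γ-E⇔CL-after-P E P (old≢E a) (P⊀old a) (P⊀old b)) (Cyclic-rotate⇔ _<ₗ_))
  ... | inj₁ refl | inj₁ refl | _         = mk⇔ (⊥-elim ∘ γ-irrefl₁₂) (⊥-elim ∘ CL-irrefl₁₂)
  ... | inj₁ refl | _         | inj₁ refl = mk⇔ (⊥-elim ∘ γ-irrefl₁₃) (⊥-elim ∘ CL-irrefl₁₃)
  ... | _         | inj₁ refl | inj₁ refl = mk⇔ (⊥-elim ∘ γ-irrefl₂₃) (⊥-elim ∘ CL-irrefl₂₃)

  realisation : Emb (FinObj.str B) (Katetov.KStr A)
  realisation = record
    { emb = realise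
    ; inj = realise-injective
    ; pres = λ x y w → ⇔-trans (pres eB x y w) (⇔-trans (γ⇔CL-placed x y w)
        (⇔-sym (CL-lift-transfer (FinObj.embM A) (eB ∘ₑ ζ) (realise x) (realise y) (realise w)))) }

katetovFunctor : KatetovFunctor
katetovFunctor = record
  { K₀ = Katetov.K₀
  ; K₁ = λ {A} {B} → K₁ {A} {B}
  ; K-cong = λ f≈g x → cong (_, proj₂ x) (f≈g (proj₁ x))
  ; K-id = λ _ _ → refl
  ; K-∘ = λ _ _ _ → refl
  ; η = Katetov.η
  ; natural = λ _ _ → refl
  ; katetov = λ {A} {B} ζ ext → OnePointRealisation.realisation {A} {B} ζ ext , OnePointRealisation.realise-old {A} {B} ζ ext
  }

proposition5p9 : LocalSWIR × KatetovFunctor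
proposition5p9 = localSWIR , katetovFunctor
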